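{- For every $t\in\mathbb{Q}\cap[0,1]$ with $t\neq 1$ (i.e. every $q$-Markov number other than $m^{1/1}_q=q+q^{ -1}$), the sequence of coefficients of the Laurent polynomial $m^t_q$ is unimodal.
   Context: Let $q$ be a formal variable and $[3]_q=q^2+q+1$. Two rationals $\frac{r}{s}<\frac{r'}{s'}$ in $[0,1]$, written in lowest terms with $s,s'>0$, are Farey neighbours if $r's-rs'=1$; every rational in $(0,1)$ is the mediant $\frac{r+r'}{s+s'}$ of exactly one pair of Farey neighbours in $[0,1]$. The $q$-Markov numbers $m^t_q\in\mathbb{Z}[q^{\pm1}]$, for $t\in(\mathbb{Q}\cap[0,1])\cup\{\frac10\}$, are defined recursively by $m^{0/1}_q=1$, $m^{1/1}_q=q+q^{ -1}$, $m^{1/0}_q=1$, and, for Farey neighbours $\frac rs<\frac{r'}{s'}$ in $[0,1]$, $$m_q^{\frac{r+r'}{s+s'}}=q^{ -1}[3]_q\,m_q^{r/s}\,m_q^{r'/s'}-m_q^{\frac{r'-r}{s'-s}},$$ where $\frac{r'-r}{s'-s}$ is understood as the rational number it represents (it is $\frac10$ for the pair $\frac01,\frac11$). A sequence of coefficients $a_{ -d},\dots,a_d$ (from lowest to highest degree) is unimodal if there is an index $j$ with $a_{ -d}\le\dots\le a_j\ge a_{j+1}\ge\dots\ge a_d$. -}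

module Defs where

open import Data.Nat as ℕ using (ℕ; zero; suc)
open import Data.Integer as ℤ using (ℤ; +_; -[1+_])
open import Data.List using (List; []; _∷_; map; length; reverse)
open import Data.Bool using (Bool; true; false; if_then_else_)
open import Data.Product using (Σ; _×_)
open import Data.Rational using (ℚ)
import Data.Rational as ℚ

-- Laurent polynomials in ℤ[q, q⁻¹]:  ⟨ k , a₀ ∷ a₁ ∷ … ⟩  stands for
--   a₀ q^k + a₁ q^(k+1) + …

record Laurent : Set where
  constructor ⟨_,_⟩
  field
    low    : ℤ
    coeffs : List ℤ
open Laurent public

addL : List ℤ → List ℤ → List ℤ
addL []       ys       = ys
addL xs       []       = xs
addL (x ∷ xs) (y ∷ ys) = (x ℤ.+ y) ∷ addL xs ys

mulL : List ℤ → List ℤ → List ℤ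
mulL []       ys = []
mulL (x ∷ xs) ys = addL (map (x ℤ.*_) ys) (+ 0 ∷ mulL xs ys)

zeros : ℕ → List ℤ
zeros zero    = []
zeros (suc n) = + 0 ∷ zeros n

-- re-express the coefficient list of p starting from a degree m ≤ low p
padTo : ℤ → Laurent → List ℤ
padTo m p = zeros ℤ.∣ low p ℤ.- m ∣ Data.List.++ coeffs p
  where import Data.List

minℤ : ℤ → ℤ → ℤ
minℤ = ℤ._⊓_

_⊕_ : Laurent → Laurent → Laurent
p ⊕ r = ⟨ m , addL (padTo m p) (padTo m r) ⟩
  where m = minℤ (low p) (low r)

⊖_ : Laurent → Laurent
⊖ p = ⟨ low p , map ℤ.-_ (coeffs p) ⟩

_⊗_ : Laurent → Laurent → Laurent
p ⊗ r = ⟨ low p ℤ.+ low r , mulL (coeffs p) (coeffs r) ⟩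

infixl 6 _⊕_
infixl 7 _⊗_

oneL : Laurent
oneL = ⟨ + 0 , + 1 ∷ [] ⟩

q⁻¹[3] : Laurent
q⁻¹[3] = ⟨ -[1+ 0 ] , + 1 ∷ + 1 ∷ + 1 ∷ [] ⟩

q+q⁻¹ : Laurent
q+q⁻¹ = ⟨ -[1+ 0 ] , + 1 ∷ + 0 ∷ + 1 ∷ [] ⟩

-- q-Markov numbers via the Farey (Stern–Brocot) tree.
-- State: Farey neighbours a/b < c/d, with mL = m^{a/b}, mR = m^{c/d},
-- mD = m^{(c-a)/(d-b)}.  The mediant gets
--   m^{(a+c)/(b+d)} = q⁻¹[3] mL mR − mD.
-- Left child interval (a/b, (a+c)/(b+d)) has difference fraction c/d;
-- right child interval ((a+c)/(b+d), c/d) has difference fraction a/b.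
-- We search for the target p/s (lowest terms, 0 < p/s < 1); fuel p+s
-- always suffices (the Stern–Brocot depth of p/s is < p + s).

markovSearch : ℕ → (a b c d : ℕ) → (mL mR mD : Laurent) → (p s : ℕ) → Laurent
markovSearch zero    a b c d mL mR mD p s = ⟨ + 0 , [] ⟩  -- unreachable
markovSearch (suc n) a b c d mL mR mD p s =
  if (p ℕ.* (b ℕ.+ d)) ℕ.≡ᵇ (s ℕ.* (a ℕ.+ c)) then mM
  else if (p ℕ.* (b ℕ.+ d)) ℕ.<ᵇ (s ℕ.* (a ℕ.+ c))
    then markovSearch n a b (a ℕ.+ c) (b ℕ.+ d) mL mM mR p s
    else markovSearch n (a ℕ.+ c) (b ℕ.+ d) c d mM mR mL p s
  where mM = q⁻¹[3] ⊗ mL ⊗ mR ⊕ ⊖ mD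

-- m^{p/s}_q for p/s in lowest terms, 0 ≤ p/s ≤ 1
markovNat : ℕ → ℕ → Laurent
markovNat p s =
  if p ℕ.≡ᵇ 0 then oneL
  else if p ℕ.≡ᵇ s then q+q⁻¹
  else markovSearch (p ℕ.+ s) 0 1 1 1 oneL q+q⁻¹ oneL p s

-- m^t_q for t ∈ ℚ ∩ [0,1]  (values outside [0,1] are irrelevant)
markovQ : ℚ → Laurent
markovQ t = markovNat ℤ.∣ ℚ.numerator t ∣ (ℚ.denominatorℕ t)

-- Unimodality of the coefficient sequence (lowest to highest degree),
-- taken between the lowest and highest nonzero coefficients.

dropZeros : List ℤ → List ℤ
dropZeros []       = []
dropZeros (+ 0 ∷ xs) = dropZeros xs
dropZeros (x ∷ xs) = x ∷ xs

trim : List ℤ → List ℤ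
trim xs = reverse (dropZeros (reverse (dropZeros xs)))

at : List ℤ → ℕ → ℤ
at []       _       = + 0
at (x ∷ xs) zero    = x
at (x ∷ xs) (suc i) = at xs i

UnimodalList : List ℤ → Set
UnimodalList xs = Σ ℕ λ j →
    (∀ i → suc i ℕ.≤ j → suc i ℕ.< length xs → at xs i ℤ.≤ at xs (suc i))
  × (∀ i → j ℕ.≤ i → suc i ℕ.< length xs → at xs (suc i) ℤ.≤ at xs i)

Unimodal : Laurent → Set
Unimodal p = UnimodalList (trim (coeffs p))

module Submission where

-- Write Q = q + q⁻¹, so q⁻¹[3] = Q + 1 and the recursion reads M = L R + E with
-- E = Q L R − D.  We show that every m^t except m^{1/1} = Q lies in the cone of
-- Laurent polynomials that are invariant under q ↦ q⁻¹ and whose coefficients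
-- decrease away from degree 0; these are unimodal.  The cone is closed under sums
-- and products (it is spanned by the intervals q⁻ᵏ + … + qᵏ), but not under
-- multiplication by Q.  So along the Farey tree we carry the facts that X, X² − 1
-- and Q X² − 1 for every node X, and E for every triple, stay in the cone after
-- multiplication by Q or Q²; identities such as Q L M − R = (Q L² − 1) R + L (Q E)
-- propagate them from a triple to its two children.  Near the root and along the
-- edges L = 1 and R = Q the invariant needs variants, and the first few triples
-- are checked by computation.

open import Defs
open import Data.Rational using (ℚ; 0ℚ; 1ℚ; _≤_)
open import Relation.Binary.PropositionalEquality using (_≢_)

open import Algebra.Solver.Ring.AlmostCommutativeRing using (AlmostCommutativeRing; _-Raw-AlmostCommutative⟶_)
import Algebra.Solver.Ring as RingSolver
open import Data.Bool using (Bool; true; false; _∧_; T)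
open import Data.Integer as ℤ using (ℤ; +_; -[1+_]; 0ℤ; 1ℤ; _⊖_)
import Data.Integer.Properties as ℤₚ
open import Data.Integer.Solver using (module +-*-Solver)
open import Data.List using (List; []; _∷_; _++_; _∷ʳ_; map; length; reverse)
import Data.List.Properties as Listₚ
open import Data.Maybe using (Maybe; just; nothing)
open import Data.Nat as ℕ using (ℕ; zero; suc; z≤n; s≤s)
import Data.Nat.Properties as ℕₚ
open import Data.Product using (_×_; _,_; proj₁; proj₂)
open import Data.Rational using (mkℚ; *≤*)
open import Data.Rational.Base using (*≡*)
open import Data.Rational.Properties using (≃⇒≡)
open import Data.Sum using (inj₁; inj₂)
open import Data.Unit using (tt)
open import Relation.Binary.PropositionalEquality
  using (_≡_; refl; sym; trans; cong; cong₂; subst; subst₂; module ≡-Reasoning)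
open import Relation.Nullary using (Dec; yes; no; does; contradiction)

atℤ : List ℤ → ℤ → ℤ
atℤ xs (+ m)    = at xs m
atℤ xs -[1+ m ] = 0ℤ

coeff : Laurent → ℤ → ℤ
coeff p n = atℤ (coeffs p) (n ℤ.- low p)

-- The representation of a Laurent polynomial is not unique (padding zeros, choice
-- of low), so polynomials are compared through their coefficient functions.
infix 4 _≈_
_≈_ : Laurent → Laurent → Set
p ≈ r = ∀ n → coeff p n ≡ coeff r n

module Coefficients where
  open +-*-Solver

  at-addL : ∀ xs ys m → at (addL xs ys) m ≡ at xs m ℤ.+ at ys m
  at-addL []       ys       m       = sym (ℤₚ.+-identityˡ _)
  at-addL (x ∷ xs) []       zero    = sym (ℤₚ.+-identityʳ _)
  at-addL (x ∷ xs) []       (suc m) = sym (ℤₚ.+-identityʳ _)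
  at-addL (x ∷ xs) (y ∷ ys) zero    = refl
  at-addL (x ∷ xs) (y ∷ ys) (suc m) = at-addL xs ys m

  atℤ-addL : ∀ xs ys z → atℤ (addL xs ys) z ≡ atℤ xs z ℤ.+ atℤ ys z
  atℤ-addL xs ys (+ m)    = at-addL xs ys m
  atℤ-addL xs ys -[1+ m ] = refl

  at-map : ∀ f → f 0ℤ ≡ 0ℤ → ∀ xs m → at (map f xs) m ≡ f (at xs m)
  at-map f f0≡0 []       m       = sym f0≡0
  at-map f f0≡0 (x ∷ xs) zero    = refl
  at-map f f0≡0 (x ∷ xs) (suc m) = at-map f f0≡0 xs m

  atℤ-map : ∀ f → f 0ℤ ≡ 0ℤ → ∀ xs z → atℤ (map f xs) z ≡ f (atℤ xs z)
  atℤ-map f f0≡0 xs (+ m)    = at-map f f0≡0 xs m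
  atℤ-map f f0≡0 xs -[1+ m ] = sym f0≡0

  atℤ-[] : ∀ z → atℤ [] z ≡ 0ℤ
  atℤ-[] (+ m)    = refl
  atℤ-[] -[1+ m ] = refl

  atℤ-0∷ : ∀ xs z → atℤ (0ℤ ∷ xs) z ≡ atℤ xs (z ℤ.- 1ℤ)
  atℤ-0∷ xs (+ zero)  = refl
  atℤ-0∷ xs (+ suc m) = refl
  atℤ-0∷ xs -[1+ m ]  = refl

  atℤ-zeros++ : ∀ k xs z → atℤ (zeros k ++ xs) z ≡ atℤ xs (z ℤ.- + k)
  atℤ-zeros++ zero    xs z = cong (atℤ xs) (sym (ℤₚ.+-identityʳ z))
  atℤ-zeros++ (suc k) xs z = begin
    atℤ (0ℤ ∷ zeros k ++ xs) z      ≡⟨ atℤ-0∷ (zeros k ++ xs) z ⟩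
    atℤ (zeros k ++ xs) (z ℤ.- 1ℤ)  ≡⟨ atℤ-zeros++ k xs (z ℤ.- 1ℤ) ⟩
    atℤ xs (z ℤ.- 1ℤ ℤ.- + k)       ≡⟨ cong (atℤ xs) (shift z (+ k)) ⟩
    atℤ xs (z ℤ.- + suc k)          ∎
    where
    open ≡-Reasoning
    shift : ∀ z k → z ℤ.- 1ℤ ℤ.- k ≡ z ℤ.- (1ℤ ℤ.+ k)
    shift = solve 2 (λ z k → z :- con 1ℤ :- k := z :- (con 1ℤ :+ k)) refl

  coeff-padTo : ∀ m p → m ℤ.≤ low p → ∀ n → atℤ (padTo m p) (n ℤ.- m) ≡ coeff p n
  coeff-padTo m p m≤low n = trans (atℤ-zeros++ ℤ.∣ low p ℤ.- m ∣ (coeffs p) (n ℤ.- m))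
    (cong (atℤ (coeffs p))
      (trans (cong (λ u → n ℤ.- m ℤ.- u) (ℤₚ.0≤i⇒+∣i∣≡i (ℤₚ.i≤j⇒0≤j-i m≤low)))
             (cancel n m (low p))))
    where
    cancel : ∀ n m l → n ℤ.- m ℤ.- (l ℤ.- m) ≡ n ℤ.- l
    cancel = solve 3 (λ n m l → n :- m :- (l :- m) := n :- l) refl

  coeff-⊕ : ∀ p r n → coeff (p ⊕ r) n ≡ coeff p n ℤ.+ coeff r n
  coeff-⊕ p r n = trans (atℤ-addL (padTo m p) (padTo m r) (n ℤ.- m))
    (cong₂ ℤ._+_ (coeff-padTo m p (ℤₚ.i⊓j≤i (low p) (low r)) n)
                 (coeff-padTo m r (ℤₚ.i⊓j≤j (low p) (low r)) n))
    where m = low p ℤ.⊓ low r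

  coeff-⊖ : ∀ p n → coeff (⊖ p) n ≡ ℤ.- coeff p n
  coeff-⊖ p n = atℤ-map ℤ.-_ refl (coeffs p) (n ℤ.- low p)

  -- convolve xs k f n is the coefficient of qⁿ in (Σᵢ xsᵢ q^(k+i)) · F,
  -- where F is the Laurent polynomial with coefficient function f.
  convolve : List ℤ → ℤ → (ℤ → ℤ) → ℤ → ℤ
  convolve []       k f n = 0ℤ
  convolve (x ∷ xs) k f n = x ℤ.* f (n ℤ.- k) ℤ.+ convolve xs (k ℤ.+ 1ℤ) f n

  atℤ-mulL : ∀ xs ys lp lr n →
             atℤ (mulL xs ys) (n ℤ.- (lp ℤ.+ lr)) ≡ convolve xs lp (coeff ⟨ lr , ys ⟩) n
  atℤ-mulL []       ys lp lr n = atℤ-[] (n ℤ.- (lp ℤ.+ lr))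
  atℤ-mulL (x ∷ xs) ys lp lr n = begin
    atℤ (mulL (x ∷ xs) ys) z
      ≡⟨ atℤ-addL (map (x ℤ.*_) ys) (0ℤ ∷ mulL xs ys) z ⟩
    atℤ (map (x ℤ.*_) ys) z ℤ.+ atℤ (0ℤ ∷ mulL xs ys) z
      ≡⟨ cong₂ ℤ._+_ (atℤ-map (x ℤ.*_) (ℤₚ.*-zeroʳ x) ys z) (atℤ-0∷ (mulL xs ys) z) ⟩
    x ℤ.* atℤ ys z ℤ.+ atℤ (mulL xs ys) (z ℤ.- 1ℤ)
      ≡⟨ cong₂ (λ u v → x ℤ.* atℤ ys u ℤ.+ atℤ (mulL xs ys) v) (split n lp lr) (next n lp lr) ⟩
    x ℤ.* atℤ ys (n ℤ.- lp ℤ.- lr) ℤ.+ atℤ (mulL xs ys) (n ℤ.- (lp ℤ.+ 1ℤ ℤ.+ lr))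
      ≡⟨ cong (λ u → x ℤ.* atℤ ys (n ℤ.- lp ℤ.- lr) ℤ.+ u) (atℤ-mulL xs ys (lp ℤ.+ 1ℤ) lr n) ⟩
    convolve (x ∷ xs) lp (coeff ⟨ lr , ys ⟩) n ∎
    where
    open ≡-Reasoning
    z = n ℤ.- (lp ℤ.+ lr)
    split : ∀ n lp lr → n ℤ.- (lp ℤ.+ lr) ≡ n ℤ.- lp ℤ.- lr
    split = solve 3 (λ n lp lr → n :- (lp :+ lr) := n :- lp :- lr) refl
    next : ∀ n lp lr → n ℤ.- (lp ℤ.+ lr) ℤ.- 1ℤ ≡ n ℤ.- (lp ℤ.+ 1ℤ ℤ.+ lr)
    next = solve 3 (λ n lp lr → n :- (lp :+ lr) :- con 1ℤ := n :- (lp :+ con 1ℤ :+ lr)) refl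

  coeff-⊗ : ∀ p r n → coeff (p ⊗ r) n ≡ convolve (coeffs p) (low p) (coeff r) n
  coeff-⊗ p r n = atℤ-mulL (coeffs p) (coeffs r) (low p) (low r) n

  convolve-cong : ∀ xs k {f g} → (∀ m → f m ≡ g m) → ∀ n → convolve xs k f n ≡ convolve xs k g n
  convolve-cong []       k f≗g n = refl
  convolve-cong (x ∷ xs) k f≗g n = cong₂ ℤ._+_ (cong (x ℤ.*_) (f≗g _)) (convolve-cong xs _ f≗g n)

  convolve-+ : ∀ xs k f g n →
               convolve xs k (λ m → f m ℤ.+ g m) n ≡ convolve xs k f n ℤ.+ convolve xs k g n
  convolve-+ []       k f g n = refl
  convolve-+ (x ∷ xs) k f g n =
    trans (cong₂ ℤ._+_ (ℤₚ.*-distribˡ-+ x (f (n ℤ.- k)) (g (n ℤ.- k))) (convolve-+ xs (k ℤ.+ 1ℤ) f g n))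
          (interchange (x ℤ.* f (n ℤ.- k)) (x ℤ.* g (n ℤ.- k))
                       (convolve xs (k ℤ.+ 1ℤ) f n) (convolve xs (k ℤ.+ 1ℤ) g n))
    where
    interchange : ∀ a b c d → a ℤ.+ b ℤ.+ (c ℤ.+ d) ≡ a ℤ.+ c ℤ.+ (b ℤ.+ d)
    interchange = solve 4 (λ a b c d → a :+ b :+ (c :+ d) := a :+ c :+ (b :+ d)) refl

  convolve-zero : ∀ xs k n → convolve xs k (λ _ → 0ℤ) n ≡ 0ℤ
  convolve-zero []       k n = refl
  convolve-zero (x ∷ xs) k n = cong₂ ℤ._+_ (ℤₚ.*-zeroʳ x) (convolve-zero xs _ n)

  convolve-scale : ∀ xs k c f n → convolve xs k (λ m → c ℤ.* f m) n ≡ c ℤ.* convolve xs k f n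
  convolve-scale []       k c f n = sym (ℤₚ.*-zeroʳ c)
  convolve-scale (x ∷ xs) k c f n =
    trans (cong (λ u → x ℤ.* (c ℤ.* f (n ℤ.- k)) ℤ.+ u) (convolve-scale xs (k ℤ.+ 1ℤ) c f n))
          (factor x c _ _)
    where
    factor : ∀ x c a b → x ℤ.* (c ℤ.* a) ℤ.+ c ℤ.* b ≡ c ℤ.* (x ℤ.* a ℤ.+ b)
    factor = solve 4 (λ x c a b → x :* (c :* a) :+ c :* b := c :* (x :* a :+ b)) refl

  convolve-neg : ∀ xs k f n → convolve xs k (λ m → ℤ.- f m) n ≡ ℤ.- convolve xs k f n
  convolve-neg xs k f n = begin
    convolve xs k (λ m → ℤ.- f m) n          ≡⟨ convolve-cong xs k (λ m → sym (ℤₚ.-1*i≡-i (f m))) n ⟩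
    convolve xs k (λ m → ℤ.- 1ℤ ℤ.* f m) n   ≡⟨ convolve-scale xs k (ℤ.- 1ℤ) f n ⟩
    ℤ.- 1ℤ ℤ.* convolve xs k f n             ≡⟨ ℤₚ.-1*i≡-i _ ⟩
    ℤ.- convolve xs k f n                    ∎
    where open ≡-Reasoning

  convolve-shift : ∀ ys a b f n → convolve ys b f (n ℤ.- a) ≡ convolve ys (a ℤ.+ b) f n
  convolve-shift []       a b f n = refl
  convolve-shift (y ∷ ys) a b f n = cong₂ ℤ._+_ (cong (λ u → y ℤ.* f u) (sub-sub n a b))
    (trans (convolve-shift ys a (b ℤ.+ 1ℤ) f n) (cong (λ u → convolve ys u f n) (sym (ℤₚ.+-assoc a b 1ℤ))))
    where
    sub-sub : ∀ n a b → n ℤ.- a ℤ.- b ≡ n ℤ.- (a ℤ.+ b)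
    sub-sub = solve 3 (λ n a b → n :- a :- b := n :- (a :+ b)) refl

  convolve-addL : ∀ u v k f n → convolve (addL u v) k f n ≡ convolve u k f n ℤ.+ convolve v k f n
  convolve-addL []      v       k f n = sym (ℤₚ.+-identityˡ _)
  convolve-addL (x ∷ u) []      k f n = sym (ℤₚ.+-identityʳ _)
  convolve-addL (x ∷ u) (y ∷ v) k f n =
    trans (cong₂ ℤ._+_ (ℤₚ.*-distribʳ-+ (f (n ℤ.- k)) x y) (convolve-addL u v (k ℤ.+ 1ℤ) f n))
          (interchange (x ℤ.* f (n ℤ.- k)) (y ℤ.* f (n ℤ.- k))
                       (convolve u (k ℤ.+ 1ℤ) f n) (convolve v (k ℤ.+ 1ℤ) f n))
    where
    interchange : ∀ a b c d → a ℤ.+ b ℤ.+ (c ℤ.+ d) ≡ a ℤ.+ c ℤ.+ (b ℤ.+ d)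
    interchange = solve 4 (λ a b c d → a :+ b :+ (c :+ d) := a :+ c :+ (b :+ d)) refl

  convolve-map* : ∀ c u k f n → convolve (map (c ℤ.*_) u) k f n ≡ c ℤ.* convolve u k f n
  convolve-map* c []      k f n = sym (ℤₚ.*-zeroʳ c)
  convolve-map* c (x ∷ u) k f n =
    trans (cong (λ w → c ℤ.* x ℤ.* f (n ℤ.- k) ℤ.+ w) (convolve-map* c u (k ℤ.+ 1ℤ) f n))
          (factor x c _ _)
    where
    factor : ∀ x c a b → c ℤ.* x ℤ.* a ℤ.+ c ℤ.* b ≡ c ℤ.* (x ℤ.* a ℤ.+ b)
    factor = solve 4 (λ x c a b → c :* x :* a :+ c :* b := c :* (x :* a :+ b)) refl

  δ : ℤ → ℤ
  δ (+ zero)  = 1ℤ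
  δ (+ suc _) = 0ℤ
  δ -[1+ _ ]  = 0ℤ

  atℤ-∷ : ∀ y ys z → atℤ (y ∷ ys) z ≡ y ℤ.* δ z ℤ.+ atℤ ys (z ℤ.- 1ℤ)
  atℤ-∷ y ys (+ zero)  = trans (sym (ℤₚ.*-identityʳ y)) (sym (ℤₚ.+-identityʳ _))
  atℤ-∷ y ys (+ suc m) = sym (trans (cong (ℤ._+ at ys m) (ℤₚ.*-zeroʳ y)) (ℤₚ.+-identityˡ _))
  atℤ-∷ y ys -[1+ m ]  = sym (trans (cong (ℤ._+ 0ℤ) (ℤₚ.*-zeroʳ y)) refl)

  coeff-∷ : ∀ b y ys m → coeff ⟨ b , y ∷ ys ⟩ m ≡ y ℤ.* δ (m ℤ.- b) ℤ.+ coeff ⟨ b ℤ.+ 1ℤ , ys ⟩ m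
  coeff-∷ b y ys m =
    trans (atℤ-∷ y ys (m ℤ.- b)) (cong (λ u → y ℤ.* δ (m ℤ.- b) ℤ.+ atℤ ys u) (sub-sub m b))
    where
    sub-sub : ∀ m b → m ℤ.- b ℤ.- 1ℤ ≡ m ℤ.- (b ℤ.+ 1ℤ)
    sub-sub = solve 2 (λ m b → m :- b :- con 1ℤ := m :- (b :+ con 1ℤ)) refl

  convolve-δ : ∀ ys b a n → convolve ys b (λ m → δ (m ℤ.- a)) n ≡ coeff ⟨ b , ys ⟩ (n ℤ.- a)
  convolve-δ []       b a n = sym (atℤ-[] (n ℤ.- a ℤ.- b))
  convolve-δ (y ∷ ys) b a n =
    trans (cong₂ ℤ._+_ (cong (λ u → y ℤ.* δ u) (swap n b a)) (convolve-δ ys (b ℤ.+ 1ℤ) a n))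
          (sym (coeff-∷ b y ys (n ℤ.- a)))
    where
    swap : ∀ n b a → n ℤ.- b ℤ.- a ≡ n ℤ.- a ℤ.- b
    swap = solve 3 (λ n b a → n :- b :- a := n :- a :- b) refl

  convolve-comm : ∀ xs a ys b n → convolve xs a (coeff ⟨ b , ys ⟩) n ≡ convolve ys b (coeff ⟨ a , xs ⟩) n
  convolve-comm []       a ys b n =
    sym (trans (convolve-cong ys b (λ m → atℤ-[] (m ℤ.- a)) n) (convolve-zero ys b n))
  convolve-comm (x ∷ xs) a ys b n = begin
    x ℤ.* coeff ⟨ b , ys ⟩ (n ℤ.- a) ℤ.+ convolve xs (a ℤ.+ 1ℤ) (coeff ⟨ b , ys ⟩) n
      ≡⟨ cong₂ ℤ._+_ (cong (x ℤ.*_) (sym (convolve-δ ys b a n))) (convolve-comm xs (a ℤ.+ 1ℤ) ys b n) ⟩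
    x ℤ.* convolve ys b (λ m → δ (m ℤ.- a)) n ℤ.+ convolve ys b (coeff ⟨ a ℤ.+ 1ℤ , xs ⟩) n
      ≡⟨ cong (ℤ._+ _) (sym (convolve-scale ys b x (λ m → δ (m ℤ.- a)) n)) ⟩
    convolve ys b (λ m → x ℤ.* δ (m ℤ.- a)) n ℤ.+ convolve ys b (coeff ⟨ a ℤ.+ 1ℤ , xs ⟩) n
      ≡⟨ sym (convolve-+ ys b _ _ n) ⟩
    convolve ys b (λ m → x ℤ.* δ (m ℤ.- a) ℤ.+ coeff ⟨ a ℤ.+ 1ℤ , xs ⟩ m) n
      ≡⟨ convolve-cong ys b (λ m → sym (coeff-∷ a x xs m)) n ⟩
    convolve ys b (coeff ⟨ a , x ∷ xs ⟩) n ∎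
    where open ≡-Reasoning

  convolve-mulL : ∀ xs ys a b f n → convolve (mulL xs ys) (a ℤ.+ b) f n ≡ convolve xs a (convolve ys b f) n
  convolve-mulL []       ys a b f n = refl
  convolve-mulL (x ∷ xs) ys a b f n = begin
    convolve (addL (map (x ℤ.*_) ys) (0ℤ ∷ mulL xs ys)) (a ℤ.+ b) f n
      ≡⟨ convolve-addL (map (x ℤ.*_) ys) (0ℤ ∷ mulL xs ys) (a ℤ.+ b) f n ⟩
    convolve (map (x ℤ.*_) ys) (a ℤ.+ b) f n
      ℤ.+ (0ℤ ℤ.* f (n ℤ.- (a ℤ.+ b)) ℤ.+ convolve (mulL xs ys) (a ℤ.+ b ℤ.+ 1ℤ) f n)
      ≡⟨ cong₂ ℤ._+_ (convolve-map* x ys (a ℤ.+ b) f n)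
                     (trans (cong (ℤ._+ convolve (mulL xs ys) (a ℤ.+ b ℤ.+ 1ℤ) f n)
                                  (ℤₚ.*-zeroˡ (f (n ℤ.- (a ℤ.+ b)))))
                            (ℤₚ.+-identityˡ _)) ⟩
    x ℤ.* convolve ys (a ℤ.+ b) f n ℤ.+ convolve (mulL xs ys) (a ℤ.+ b ℤ.+ 1ℤ) f n
      ≡⟨ cong (λ u → x ℤ.* u ℤ.+ convolve (mulL xs ys) (a ℤ.+ b ℤ.+ 1ℤ) f n) (sym (convolve-shift ys a b f n)) ⟩
    x ℤ.* convolve ys b f (n ℤ.- a) ℤ.+ convolve (mulL xs ys) (a ℤ.+ b ℤ.+ 1ℤ) f n
      ≡⟨ cong (λ v → x ℤ.* convolve ys b f (n ℤ.- a) ℤ.+ convolve (mulL xs ys) v f n) (swap a b) ⟩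
    x ℤ.* convolve ys b f (n ℤ.- a) ℤ.+ convolve (mulL xs ys) (a ℤ.+ 1ℤ ℤ.+ b) f n
      ≡⟨ cong (λ u → x ℤ.* convolve ys b f (n ℤ.- a) ℤ.+ u) (convolve-mulL xs ys (a ℤ.+ 1ℤ) b f n) ⟩
    convolve (x ∷ xs) a (convolve ys b f) n ∎
    where
    open ≡-Reasoning
    swap : ∀ a b → a ℤ.+ b ℤ.+ 1ℤ ≡ a ℤ.+ 1ℤ ℤ.+ b
    swap = solve 2 (λ a b → a :+ b :+ con 1ℤ := a :+ con 1ℤ :+ b) refl

open Coefficients

zeroL : Laurent
zeroL = ⟨ 0ℤ , [] ⟩

constL : ℤ → Laurent
constL c = ⟨ 0ℤ , c ∷ [] ⟩

infixl 6 _⊝_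
_⊝_ : Laurent → Laurent → Laurent
p ⊝ r = p ⊕ ⊖ r

module RingLaws where
  open import Algebra.Structures _≈_ using (IsCommutativeSemiring)
  import Algebra.Structures.Biased _≈_ as Biased
  open import Relation.Binary.Structures using (IsEquivalence)

  ≈-refl : ∀ {p} → p ≈ p
  ≈-refl n = refl

  ≈-sym : ∀ {p r} → p ≈ r → r ≈ p
  ≈-sym p≈r n = sym (p≈r n)

  ≈-trans : ∀ {p r s} → p ≈ r → r ≈ s → p ≈ s
  ≈-trans p≈r r≈s n = trans (p≈r n) (r≈s n)

  ≈-isEquivalence : IsEquivalence _≈_
  ≈-isEquivalence = record { refl = ≈-refl ; sym = ≈-sym ; trans = ≈-trans }

  ⊕-cong : ∀ {p p′ r r′} → p ≈ p′ → r ≈ r′ → p ⊕ r ≈ p′ ⊕ r′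
  ⊕-cong {p} {p′} {r} {r′} p≈p′ r≈r′ n =
    trans (coeff-⊕ p r n) (trans (cong₂ ℤ._+_ (p≈p′ n) (r≈r′ n)) (sym (coeff-⊕ p′ r′ n)))

  ⊕-comm : ∀ p r → p ⊕ r ≈ r ⊕ p
  ⊕-comm p r n = trans (coeff-⊕ p r n) (trans (ℤₚ.+-comm (coeff p n) (coeff r n)) (sym (coeff-⊕ r p n)))

  ⊕-assoc : ∀ p r s → (p ⊕ r) ⊕ s ≈ p ⊕ (r ⊕ s)
  ⊕-assoc p r s n = begin
    coeff ((p ⊕ r) ⊕ s) n                  ≡⟨ coeff-⊕ (p ⊕ r) s n ⟩
    coeff (p ⊕ r) n ℤ.+ coeff s n          ≡⟨ cong (ℤ._+ coeff s n) (coeff-⊕ p r n) ⟩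
    coeff p n ℤ.+ coeff r n ℤ.+ coeff s n  ≡⟨ ℤₚ.+-assoc (coeff p n) (coeff r n) (coeff s n) ⟩
    coeff p n ℤ.+ (coeff r n ℤ.+ coeff s n) ≡⟨ cong (λ u → coeff p n ℤ.+ u) (coeff-⊕ r s n) ⟨
    coeff p n ℤ.+ coeff (r ⊕ s) n          ≡⟨ coeff-⊕ p (r ⊕ s) n ⟨
    coeff (p ⊕ (r ⊕ s)) n                  ∎
    where open ≡-Reasoning

  ⊕-identityˡ : ∀ p → zeroL ⊕ p ≈ p
  ⊕-identityˡ p n =
    trans (coeff-⊕ zeroL p n) (trans (cong (ℤ._+ coeff p n) (atℤ-[] (n ℤ.- 0ℤ))) (ℤₚ.+-identityˡ _))

  coeff-⊗ʳ : ∀ p r n → coeff (p ⊗ r) n ≡ convolve (coeffs r) (low r) (coeff p) n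
  coeff-⊗ʳ p r n = trans (coeff-⊗ p r n) (convolve-comm (coeffs p) (low p) (coeffs r) (low r) n)

  ⊗-comm : ∀ p r → p ⊗ r ≈ r ⊗ p
  ⊗-comm p r n = trans (coeff-⊗ʳ p r n) (sym (coeff-⊗ r p n))

  ⊗-congʳ : ∀ p {r r′} → r ≈ r′ → p ⊗ r ≈ p ⊗ r′
  ⊗-congʳ p {r} {r′} r≈r′ n =
    trans (coeff-⊗ p r n) (trans (convolve-cong (coeffs p) (low p) r≈r′ n) (sym (coeff-⊗ p r′ n)))

  ⊗-cong : ∀ {p p′ r r′} → p ≈ p′ → r ≈ r′ → p ⊗ r ≈ p′ ⊗ r′
  ⊗-cong {p} {p′} {r} {r′} p≈p′ r≈r′ =
    ≈-trans (⊗-congʳ p r≈r′) (≈-trans (⊗-comm p r′) (≈-trans (⊗-congʳ r′ p≈p′) (⊗-comm r′ p′)))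

  ⊗-assoc : ∀ p r s → (p ⊗ r) ⊗ s ≈ p ⊗ (r ⊗ s)
  ⊗-assoc p r s n = begin
    coeff ((p ⊗ r) ⊗ s) n                                       ≡⟨ coeff-⊗ (p ⊗ r) s n ⟩
    convolve (mulL (coeffs p) (coeffs r)) (low p ℤ.+ low r) (coeff s) n
      ≡⟨ convolve-mulL (coeffs p) (coeffs r) (low p) (low r) (coeff s) n ⟩
    convolve (coeffs p) (low p) (convolve (coeffs r) (low r) (coeff s)) n
      ≡⟨ convolve-cong (coeffs p) (low p) (λ m → sym (coeff-⊗ r s m)) n ⟩
    convolve (coeffs p) (low p) (coeff (r ⊗ s)) n                ≡⟨ coeff-⊗ p (r ⊗ s) n ⟨
    coeff (p ⊗ (r ⊗ s)) n                                       ∎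
    where open ≡-Reasoning

  ⊗-identityˡ : ∀ p → oneL ⊗ p ≈ p
  ⊗-identityˡ p n = trans (coeff-⊗ oneL p n)
    (trans (ℤₚ.+-identityʳ _) (trans (ℤₚ.*-identityˡ _) (cong (coeff p) (ℤₚ.+-identityʳ n))))

  ⊗-distribʳ : ∀ s p r → (p ⊕ r) ⊗ s ≈ (p ⊗ s) ⊕ (r ⊗ s)
  ⊗-distribʳ s p r n = begin
    coeff ((p ⊕ r) ⊗ s) n                                 ≡⟨ coeff-⊗ʳ (p ⊕ r) s n ⟩
    convolve (coeffs s) (low s) (coeff (p ⊕ r)) n         ≡⟨ convolve-cong (coeffs s) (low s) (coeff-⊕ p r) n ⟩
    convolve (coeffs s) (low s) (λ m → coeff p m ℤ.+ coeff r m) n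
      ≡⟨ convolve-+ (coeffs s) (low s) (coeff p) (coeff r) n ⟩
    convolve (coeffs s) (low s) (coeff p) n ℤ.+ convolve (coeffs s) (low s) (coeff r) n
      ≡⟨ cong₂ ℤ._+_ (coeff-⊗ʳ p s n) (coeff-⊗ʳ r s n) ⟨
    coeff (p ⊗ s) n ℤ.+ coeff (r ⊗ s) n                   ≡⟨ coeff-⊕ (p ⊗ s) (r ⊗ s) n ⟨
    coeff ((p ⊗ s) ⊕ (r ⊗ s)) n                           ∎
    where open ≡-Reasoning

  ⊗-distribˡ : ∀ s p r → s ⊗ (p ⊕ r) ≈ (s ⊗ p) ⊕ (s ⊗ r)
  ⊗-distribˡ s p r = ≈-trans (⊗-comm s (p ⊕ r))
    (≈-trans (⊗-distribʳ s p r) (⊕-cong (⊗-comm p s) (⊗-comm r s)))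

  ⊗-zeroˡ : ∀ p → zeroL ⊗ p ≈ zeroL
  ⊗-zeroˡ p n = trans (atℤ-[] (n ℤ.- (0ℤ ℤ.+ low p))) (sym (atℤ-[] (n ℤ.- 0ℤ)))

  ⊖-cong : ∀ {p p′} → p ≈ p′ → ⊖ p ≈ ⊖ p′
  ⊖-cong {p} {p′} p≈p′ n = trans (coeff-⊖ p n) (trans (cong ℤ.-_ (p≈p′ n)) (sym (coeff-⊖ p′ n)))

  ⊖-distribˡ-⊗ : ∀ p r → (⊖ p) ⊗ r ≈ ⊖ (p ⊗ r)
  ⊖-distribˡ-⊗ p r n = begin
    coeff (⊖ p ⊗ r) n                                          ≡⟨ coeff-⊗ʳ (⊖ p) r n ⟩
    convolve (coeffs r) (low r) (coeff (⊖ p)) n                ≡⟨ convolve-cong (coeffs r) (low r) (coeff-⊖ p) n ⟩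
    convolve (coeffs r) (low r) (λ m → ℤ.- coeff p m) n        ≡⟨ convolve-neg (coeffs r) (low r) (coeff p) n ⟩
    ℤ.- convolve (coeffs r) (low r) (coeff p) n                ≡⟨ cong ℤ.-_ (coeff-⊗ʳ p r n) ⟨
    ℤ.- coeff (p ⊗ r) n                                        ≡⟨ coeff-⊖ (p ⊗ r) n ⟨
    coeff (⊖ (p ⊗ r)) n                                        ∎
    where open ≡-Reasoning

  ⊖-⊕-comm : ∀ p r → (⊖ p) ⊕ (⊖ r) ≈ ⊖ (p ⊕ r)
  ⊖-⊕-comm p r n = begin
    coeff (⊖ p ⊕ ⊖ r) n                     ≡⟨ coeff-⊕ (⊖ p) (⊖ r) n ⟩
    coeff (⊖ p) n ℤ.+ coeff (⊖ r) n         ≡⟨ cong₂ ℤ._+_ (coeff-⊖ p n) (coeff-⊖ r n) ⟩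
    ℤ.- coeff p n ℤ.+ ℤ.- coeff r n         ≡⟨ ℤₚ.neg-distrib-+ (coeff p n) (coeff r n) ⟨
    ℤ.- (coeff p n ℤ.+ coeff r n)           ≡⟨ cong ℤ.-_ (coeff-⊕ p r n) ⟨
    ℤ.- coeff (p ⊕ r) n                     ≡⟨ coeff-⊖ (p ⊕ r) n ⟨
    coeff (⊖ (p ⊕ r)) n                     ∎
    where open ≡-Reasoning

  isCommutativeSemiring : IsCommutativeSemiring _⊕_ _⊗_ zeroL oneL
  isCommutativeSemiring = Biased.IsCommutativeSemiringˡ.isCommutativeSemiring record
    { +-isCommutativeMonoid = Biased.isCommutativeMonoidˡ record
       { isSemigroup = record { isMagma = record { isEquivalence = ≈-isEquivalence ; ∙-cong = ⊕-cong }
                              ; assoc = ⊕-assoc }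
       ; identityˡ = ⊕-identityˡ ; comm = ⊕-comm }
    ; *-isCommutativeMonoid = Biased.isCommutativeMonoidˡ record
       { isSemigroup = record { isMagma = record { isEquivalence = ≈-isEquivalence ; ∙-cong = ⊗-cong }
                              ; assoc = ⊗-assoc }
       ; identityˡ = ⊗-identityˡ ; comm = ⊗-comm }
    ; distribʳ = ⊗-distribʳ
    ; zeroˡ = ⊗-zeroˡ }

  laurentRing : AlmostCommutativeRing _ _
  laurentRing = record
    { Carrier = Laurent ; _≈_ = _≈_ ; _+_ = _⊕_ ; _*_ = _⊗_ ; -_ = ⊖_ ; 0# = zeroL ; 1# = oneL
    ; isAlmostCommutativeRing = record
      { isCommutativeSemiring = isCommutativeSemiring
      ; -‿cong = ⊖-cong ; -‿*-distribˡ = ⊖-distribˡ-⊗ ; -‿+-comm = ⊖-⊕-comm } }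

  coeff-constL : ∀ c n → coeff (constL c) n ≡ c ℤ.* δ n
  coeff-constL c n = trans (atℤ-∷ c [] (n ℤ.- 0ℤ))
    (trans (cong₂ ℤ._+_ (cong (λ u → c ℤ.* δ u) (ℤₚ.+-identityʳ n)) (atℤ-[] (n ℤ.- 0ℤ ℤ.- 1ℤ)))
           (ℤₚ.+-identityʳ _))

  constL-homomorphism : ℤ.+-*-rawRing -Raw-AlmostCommutative⟶ laurentRing
  constL-homomorphism = record
    { ⟦_⟧ = constL
    ; +-homo = λ a b n → begin
        coeff (constL (a ℤ.+ b)) n              ≡⟨ coeff-constL (a ℤ.+ b) n ⟩
        (a ℤ.+ b) ℤ.* δ n                       ≡⟨ ℤₚ.*-distribʳ-+ (δ n) a b ⟩
        a ℤ.* δ n ℤ.+ b ℤ.* δ n                 ≡⟨ cong₂ ℤ._+_ (coeff-constL a n) (coeff-constL b n) ⟨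
        coeff (constL a) n ℤ.+ coeff (constL b) n ≡⟨ coeff-⊕ (constL a) (constL b) n ⟨
        coeff (constL a ⊕ constL b) n           ∎
    ; *-homo = λ a b n → begin
        coeff (constL (a ℤ.* b)) n              ≡⟨ coeff-constL (a ℤ.* b) n ⟩
        a ℤ.* b ℤ.* δ n                         ≡⟨ ℤₚ.*-assoc a b (δ n) ⟩
        a ℤ.* (b ℤ.* δ n)                       ≡⟨ cong (a ℤ.*_) (coeff-constL b n) ⟨
        a ℤ.* coeff (constL b) n                ≡⟨ cong (λ u → a ℤ.* coeff (constL b) u) (ℤₚ.+-identityʳ n) ⟨
        a ℤ.* coeff (constL b) (n ℤ.- 0ℤ)       ≡⟨ ℤₚ.+-identityʳ _ ⟨
        a ℤ.* coeff (constL b) (n ℤ.- 0ℤ) ℤ.+ 0ℤ ≡⟨ coeff-⊗ (constL a) (constL b) n ⟨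
        coeff (constL a ⊗ constL b) n           ∎
    ; -‿homo = λ a n → begin
        coeff (constL (ℤ.- a)) n                ≡⟨ coeff-constL (ℤ.- a) n ⟩
        ℤ.- a ℤ.* δ n                           ≡⟨ ℤₚ.neg-distribˡ-* a (δ n) ⟨
        ℤ.- (a ℤ.* δ n)                         ≡⟨ cong ℤ.-_ (coeff-constL a n) ⟨
        ℤ.- coeff (constL a) n                  ≡⟨ coeff-⊖ (constL a) n ⟨
        coeff (⊖ constL a) n                    ∎
    ; 0-homo = λ n → trans (coeff-constL 0ℤ n) (trans (ℤₚ.*-zeroˡ (δ n)) (sym (atℤ-[] (n ℤ.- 0ℤ))))
    ; 1-homo = λ n → refl
    }
    where open ≡-Reasoning

  constL-≟ : ∀ a b → Maybe (constL a ≈ constL b)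
  constL-≟ a b with a ℤₚ.≟ b
  ... | yes refl = just (λ n → refl)
  ... | no _     = nothing

open RingLaws

module LaurentSolver = RingSolver ℤ.+-*-rawRing laurentRing constL-homomorphism constL-≟

record SymUnimodal (p : Laurent) : Set where
  field
    symmetric  : ∀ n → coeff p (ℤ.- n) ≡ coeff p n
    decreasing : ∀ m → coeff p (+ suc m) ℤ.≤ coeff p (+ m)
open SymUnimodal public

VanishesFrom : Laurent → ℕ → Set
VanishesFrom p N = ∀ m → N ℕ.≤ m → coeff p (+ m) ≡ 0ℤ

monomial : ℤ → Laurent
monomial a = ⟨ a , 1ℤ ∷ [] ⟩

interval : ℕ → Laurent
interval zero    = oneL
interval (suc k) = interval k ⊕ monomial (+ suc k) ⊕ monomial (ℤ.- + suc k)

module Cone where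

  SU-resp-≈ : ∀ {p r} → p ≈ r → SymUnimodal p → SymUnimodal r
  SU-resp-≈ {p} {r} p≈r su = record
    { symmetric  = λ n → trans (sym (p≈r (ℤ.- n))) (trans (symmetric su n) (p≈r n))
    ; decreasing = λ m → subst₂ ℤ._≤_ (p≈r (+ suc m)) (p≈r (+ m)) (decreasing su m) }

  SU-⊕ : ∀ {p r} → SymUnimodal p → SymUnimodal r → SymUnimodal (p ⊕ r)
  SU-⊕ {p} {r} sp sr = record
    { symmetric  = λ n → trans (coeff-⊕ p r (ℤ.- n))
                     (trans (cong₂ ℤ._+_ (symmetric sp n) (symmetric sr n)) (sym (coeff-⊕ p r n)))
    ; decreasing = λ m → subst₂ ℤ._≤_ (sym (coeff-⊕ p r (+ suc m))) (sym (coeff-⊕ p r (+ m)))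
                     (ℤₚ.+-mono-≤ (decreasing sp m) (decreasing sr m)) }

  SU-zeroL : SymUnimodal zeroL
  SU-zeroL = record
    { symmetric  = λ n → trans (atℤ-[] (ℤ.- n ℤ.- 0ℤ)) (sym (atℤ-[] (n ℤ.- 0ℤ)))
    ; decreasing = λ m → ℤₚ.≤-reflexive (trans (atℤ-[] (+ suc m ℤ.- 0ℤ)) (sym (atℤ-[] (+ m ℤ.- 0ℤ)))) }

  SU-oneL : SymUnimodal oneL
  SU-oneL = record
    { symmetric  = λ { (+ zero) → refl ; (+ suc n) → refl ; -[1+ n ] → refl }
    ; decreasing = λ { zero → ℤ.+≤+ z≤n ; (suc m) → ℤₚ.≤-refl } }

  coeff-∣∣ : ∀ {p} → SymUnimodal p → ∀ z → coeff p z ≡ coeff p (+ ℤ.∣ z ∣)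
  coeff-∣∣ su (+ m)    = refl
  coeff-∣∣ su -[1+ m ] = symmetric su (+ suc m)

  decreasing-ℕ : ∀ {p} → SymUnimodal p → ∀ {a b} → a ℕ.≤ b → coeff p (+ b) ℤ.≤ coeff p (+ a)
  decreasing-ℕ {p} su {a} {b} a≤b =
    subst (λ u → coeff p (+ u) ℤ.≤ coeff p (+ a)) (ℕₚ.m+[n∸m]≡n a≤b) (go a (b ℕ.∸ a))
    where
    go : ∀ a k → coeff p (+ (a ℕ.+ k)) ℤ.≤ coeff p (+ a)
    go a zero    = ℤₚ.≤-reflexive (cong (λ u → coeff p (+ u)) (ℕₚ.+-identityʳ a))
    go a (suc k) = ℤₚ.≤-trans
      (subst (λ u → coeff p (+ u) ℤ.≤ coeff p (+ (a ℕ.+ k))) (sym (ℕₚ.+-suc a k)) (decreasing su (a ℕ.+ k)))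
      (go a k)

  decreasing-∣∣ : ∀ {p} → SymUnimodal p → ∀ {z w} → ℤ.∣ z ∣ ℕ.≤ ℤ.∣ w ∣ → coeff p w ℤ.≤ coeff p z
  decreasing-∣∣ {p} su {z} {w} ∣z∣≤∣w∣ =
    subst₂ ℤ._≤_ (sym (coeff-∣∣ su w)) (sym (coeff-∣∣ su z)) (decreasing-ℕ su ∣z∣≤∣w∣)

  +-cancelʳ-≤ : ∀ {a b} c → a ℤ.+ c ℤ.≤ b ℤ.+ c → a ℤ.≤ b
  +-cancelʳ-≤ {a} {b} c a+c≤b+c =
    subst₂ ℤ._≤_ (cancel a c) (cancel b c) (ℤₚ.+-monoˡ-≤ (ℤ.- c) a+c≤b+c)
    where
    open +-*-Solver
    cancel : ∀ x c → x ℤ.+ c ℤ.- c ≡ x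
    cancel = solve 2 (λ x c → x :+ c :- c := x) refl

  coeff-monomial⊗ : ∀ a Y n → coeff (monomial a ⊗ Y) n ≡ coeff Y (n ℤ.- a)
  coeff-monomial⊗ a Y n = trans (coeff-⊗ (monomial a) Y n) (trans (ℤₚ.+-identityʳ _) (ℤₚ.*-identityˡ _))

  module _ {Y : Laurent} (Y-SU : SymUnimodal Y) where
    private
      g : ℤ → ℤ
      g = coeff Y
      h : ℕ → ℤ → ℤ
      h k = coeff (interval k ⊗ Y)

    coeff-interval⊗-suc : ∀ k n → h (suc k) n ≡ h k n ℤ.+ g (n ℤ.- + suc k) ℤ.+ g (n ℤ.+ + suc k)
    coeff-interval⊗-suc k n = begin
      h (suc k) n
        ≡⟨ ⊗-distribʳ Y (interval k ⊕ monomial (+ suc k)) (monomial (-[1+ k ])) n ⟩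
      coeff ((interval k ⊕ monomial (+ suc k)) ⊗ Y ⊕ monomial (-[1+ k ]) ⊗ Y) n
        ≡⟨ coeff-⊕ ((interval k ⊕ monomial (+ suc k)) ⊗ Y) (monomial (-[1+ k ]) ⊗ Y) n ⟩
      coeff ((interval k ⊕ monomial (+ suc k)) ⊗ Y) n ℤ.+ coeff (monomial (-[1+ k ]) ⊗ Y) n
        ≡⟨ cong₂ ℤ._+_ (⊗-distribʳ Y (interval k) (monomial (+ suc k)) n) (coeff-monomial⊗ (-[1+ k ]) Y n) ⟩
      coeff (interval k ⊗ Y ⊕ monomial (+ suc k) ⊗ Y) n ℤ.+ g (n ℤ.+ + suc k)
        ≡⟨ cong (ℤ._+ g (n ℤ.+ + suc k)) (coeff-⊕ (interval k ⊗ Y) (monomial (+ suc k) ⊗ Y) n) ⟩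
      h k n ℤ.+ coeff (monomial (+ suc k) ⊗ Y) n ℤ.+ g (n ℤ.+ + suc k)
        ≡⟨ cong (λ u → h k n ℤ.+ u ℤ.+ g (n ℤ.+ + suc k)) (coeff-monomial⊗ (+ suc k) Y n) ⟩
      h k n ℤ.+ g (n ℤ.- + suc k) ℤ.+ g (n ℤ.+ + suc k) ∎
      where open ≡-Reasoning

    symmetric-interval⊗ : ∀ k n → h k (ℤ.- n) ≡ h k n
    symmetric-interval⊗ zero    n = trans (⊗-identityˡ Y (ℤ.- n)) (trans (symmetric Y-SU n) (sym (⊗-identityˡ Y n)))
    symmetric-interval⊗ (suc k) n = begin
      h (suc k) (ℤ.- n)
        ≡⟨ coeff-interval⊗-suc k (ℤ.- n) ⟩
      h k (ℤ.- n) ℤ.+ g (ℤ.- n ℤ.- + suc k) ℤ.+ g (ℤ.- n ℤ.+ + suc k)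
        ≡⟨ cong₂ (λ u v → h k (ℤ.- n) ℤ.+ g u ℤ.+ g v) (neg-add n (+ suc k)) (neg-sub n (+ suc k)) ⟩
      h k (ℤ.- n) ℤ.+ g (ℤ.- (n ℤ.+ + suc k)) ℤ.+ g (ℤ.- (n ℤ.- + suc k))
        ≡⟨ cong₂ (λ u v → u ℤ.+ v ℤ.+ g (ℤ.- (n ℤ.- + suc k)))
                 (symmetric-interval⊗ k n) (symmetric Y-SU (n ℤ.+ + suc k)) ⟩
      h k n ℤ.+ g (n ℤ.+ + suc k) ℤ.+ g (ℤ.- (n ℤ.- + suc k))
        ≡⟨ cong (λ u → h k n ℤ.+ g (n ℤ.+ + suc k) ℤ.+ u) (symmetric Y-SU (n ℤ.- + suc k)) ⟩
      h k n ℤ.+ g (n ℤ.+ + suc k) ℤ.+ g (n ℤ.- + suc k)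
        ≡⟨ swap (h k n) (g (n ℤ.+ + suc k)) (g (n ℤ.- + suc k)) ⟩
      h k n ℤ.+ g (n ℤ.- + suc k) ℤ.+ g (n ℤ.+ + suc k)
        ≡⟨ coeff-interval⊗-suc k n ⟨
      h (suc k) n ∎
      where
      open ≡-Reasoning
      open +-*-Solver
      neg-add : ∀ n a → ℤ.- n ℤ.- a ≡ ℤ.- (n ℤ.+ a)
      neg-add = solve 2 (λ n a → :- n :- a := :- (n :+ a)) refl
      neg-sub : ∀ n a → ℤ.- n ℤ.+ a ≡ ℤ.- (n ℤ.- a)
      neg-sub = solve 2 (λ n a → :- n :+ a := :- (n :- a)) refl
      swap : ∀ a b c → a ℤ.+ b ℤ.+ c ≡ a ℤ.+ c ℤ.+ b
      swap = solve 3 (λ a b c → a :+ b :+ c := a :+ c :+ b) refl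

    -- h k n is the sum of g over the window [n - k, n + k]; sliding the window by one
    -- trades g (n - k) for g (n + k + 1).
    window-shift : ∀ k n → h k n ℤ.+ g (n ℤ.+ + suc k) ≡ h k (1ℤ ℤ.+ n) ℤ.+ g (n ℤ.- + k)
    window-shift zero    n = begin
      h zero n ℤ.+ g (n ℤ.+ 1ℤ)          ≡⟨ cong₂ ℤ._+_ (⊗-identityˡ Y n) (cong g (ℤₚ.+-comm n 1ℤ)) ⟩
      g n ℤ.+ g (1ℤ ℤ.+ n)               ≡⟨ ℤₚ.+-comm (g n) (g (1ℤ ℤ.+ n)) ⟩
      g (1ℤ ℤ.+ n) ℤ.+ g n
        ≡⟨ cong₂ ℤ._+_ (⊗-identityˡ Y (1ℤ ℤ.+ n)) (cong g (ℤₚ.+-identityʳ n)) ⟨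
      h zero (1ℤ ℤ.+ n) ℤ.+ g (n ℤ.- 0ℤ) ∎
      where open ≡-Reasoning
    window-shift (suc k) n = begin
      h (suc k) n ℤ.+ g (n ℤ.+ + suc (suc k))
        ≡⟨ cong (ℤ._+ g (n ℤ.+ + suc (suc k))) (coeff-interval⊗-suc k n) ⟩
      h k n ℤ.+ g (n ℤ.- + suc k) ℤ.+ g (n ℤ.+ + suc k) ℤ.+ g (n ℤ.+ + suc (suc k))
        ≡⟨ swap (h k n) (g (n ℤ.- + suc k)) (g (n ℤ.+ + suc k)) (g (n ℤ.+ + suc (suc k))) ⟩
      h k n ℤ.+ g (n ℤ.+ + suc k) ℤ.+ g (n ℤ.+ + suc (suc k)) ℤ.+ g (n ℤ.- + suc k)
        ≡⟨ cong (λ u → u ℤ.+ g (n ℤ.+ + suc (suc k)) ℤ.+ g (n ℤ.- + suc k)) (window-shift k n) ⟩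
      h k (1ℤ ℤ.+ n) ℤ.+ g (n ℤ.- + k) ℤ.+ g (n ℤ.+ + suc (suc k)) ℤ.+ g (n ℤ.- + suc k)
        ≡⟨ cong₂ (λ u v → h k (1ℤ ℤ.+ n) ℤ.+ g u ℤ.+ g v ℤ.+ g (n ℤ.- + suc k))
                 (down n (+ k)) (up n (+ suc k)) ⟩
      h k (1ℤ ℤ.+ n) ℤ.+ g (1ℤ ℤ.+ n ℤ.- + suc k) ℤ.+ g (1ℤ ℤ.+ n ℤ.+ + suc k) ℤ.+ g (n ℤ.- + suc k)
        ≡⟨ cong (ℤ._+ g (n ℤ.- + suc k)) (coeff-interval⊗-suc k (1ℤ ℤ.+ n)) ⟨
      h (suc k) (1ℤ ℤ.+ n) ℤ.+ g (n ℤ.- + suc k) ∎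
      where
      open ≡-Reasoning
      open +-*-Solver
      swap : ∀ a b c d → a ℤ.+ b ℤ.+ c ℤ.+ d ≡ a ℤ.+ c ℤ.+ d ℤ.+ b
      swap = solve 4 (λ a b c d → a :+ b :+ c :+ d := a :+ c :+ d :+ b) refl
      down : ∀ n k → n ℤ.- k ≡ 1ℤ ℤ.+ n ℤ.- (1ℤ ℤ.+ k)
      down = solve 2 (λ n k → n :- k := con 1ℤ :+ n :- (con 1ℤ :+ k)) refl
      up : ∀ n k → n ℤ.+ (1ℤ ℤ.+ k) ≡ 1ℤ ℤ.+ n ℤ.+ k
      up = solve 2 (λ n k → n :+ (con 1ℤ :+ k) := con 1ℤ :+ n :+ k) refl

    SU-interval⊗ : ∀ k → SymUnimodal (interval k ⊗ Y)
    SU-interval⊗ k = record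
      { symmetric  = symmetric-interval⊗ k
      ; decreasing = λ m → +-cancelʳ-≤ (g (+ m ℤ.+ + suc k)) (begin
          h k (+ suc m) ℤ.+ g (+ m ℤ.+ + suc k)
            ≤⟨ ℤₚ.+-monoʳ-≤ (h k (+ suc m)) (decreasing-∣∣ Y-SU {+ m ℤ.- + k} {+ m ℤ.+ + suc k} (farther m k)) ⟩
          h k (+ suc m) ℤ.+ g (+ m ℤ.- + k)      ≡⟨ window-shift k (+ m) ⟨
          h k (+ m) ℤ.+ g (+ m ℤ.+ + suc k)      ∎) }
      where
      open ℤₚ.≤-Reasoning
      farther : ∀ m k → ℤ.∣ + m ℤ.- + k ∣ ℕ.≤ ℤ.∣ + m ℤ.+ + suc k ∣
      farther m k = ℕₚ.≤-trans (ℤₚ.∣i-j∣≤∣i∣+∣j∣ (+ m) (+ k)) (ℕₚ.+-monoʳ-≤ m (ℕₚ.n≤1+n k))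

  coeff-monomial : ∀ a z → coeff (monomial a) z ≡ δ (z ℤ.- a)
  coeff-monomial a z = trans (atℤ-∷ 1ℤ [] (z ℤ.- a))
    (trans (cong₂ ℤ._+_ (ℤₚ.*-identityˡ (δ (z ℤ.- a))) (atℤ-[] (z ℤ.- a ℤ.- 1ℤ)))
           (ℤₚ.+-identityʳ (δ (z ℤ.- a))))

  δ-⊖-≢ : ∀ {m n} → m ≢ n → δ (m ⊖ n) ≡ 0ℤ
  δ-⊖-≢ {zero}  {zero}  m≢n = contradiction refl m≢n
  δ-⊖-≢ {zero}  {suc n} m≢n = refl
  δ-⊖-≢ {suc m} {zero}  m≢n = refl
  δ-⊖-≢ {suc m} {suc n} m≢n =
    trans (cong δ (ℤₚ.[1+m]⊖[1+n]≡m⊖n m n)) (δ-⊖-≢ (λ m≡n → m≢n (cong suc m≡n)))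

  coeff-interval-suc : ∀ k m → coeff (interval (suc k)) (+ m) ≡ coeff (interval k) (+ m) ℤ.+ δ (m ⊖ suc k)
  coeff-interval-suc k m = begin
    coeff (interval k ⊕ monomial (+ suc k) ⊕ monomial -[1+ k ]) (+ m)
      ≡⟨ coeff-⊕ (interval k ⊕ monomial (+ suc k)) (monomial -[1+ k ]) (+ m) ⟩
    coeff (interval k ⊕ monomial (+ suc k)) (+ m) ℤ.+ coeff (monomial -[1+ k ]) (+ m)
      ≡⟨ cong₂ ℤ._+_ (coeff-⊕ (interval k) (monomial (+ suc k)) (+ m)) (coeff-monomial -[1+ k ] (+ m)) ⟩
    coeff (interval k) (+ m) ℤ.+ coeff (monomial (+ suc k)) (+ m) ℤ.+ δ (+ (m ℕ.+ suc k))
      ≡⟨ cong₂ (λ u v → coeff (interval k) (+ m) ℤ.+ u ℤ.+ δ (+ v))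
               (trans (coeff-monomial (+ suc k) (+ m)) (cong δ (ℤₚ.m-n≡m⊖n m (suc k)))) (ℕₚ.+-suc m k) ⟩
    coeff (interval k) (+ m) ℤ.+ δ (m ⊖ suc k) ℤ.+ 0ℤ
      ≡⟨ ℤₚ.+-identityʳ _ ⟩
    coeff (interval k) (+ m) ℤ.+ δ (m ⊖ suc k) ∎
    where open ≡-Reasoning

  coeff-interval-outside : ∀ k m → k ℕ.< m → coeff (interval k) (+ m) ≡ 0ℤ
  coeff-interval-outside zero    (suc m) k<m = refl
  coeff-interval-outside (suc k) m       k<m = trans (coeff-interval-suc k m)
    (cong₂ ℤ._+_ (coeff-interval-outside k m (ℕₚ.<-trans (ℕₚ.n<1+n k) k<m))
                 (δ-⊖-≢ (λ m≡k → ℕₚ.<⇒≢ k<m (sym m≡k))))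

  coeff-interval-inside : ∀ k m → m ℕ.≤ k → coeff (interval k) (+ m) ≡ 1ℤ
  coeff-interval-inside zero    zero m≤k = refl
  coeff-interval-inside (suc k) m    m≤k with ℕₚ.m≤n⇒m<n∨m≡n m≤k
  ... | inj₁ m<k = trans (coeff-interval-suc k m)
    (cong₂ ℤ._+_ (coeff-interval-inside k m (ℕₚ.≤-pred m<k)) (δ-⊖-≢ (ℕₚ.<⇒≢ m<k)))
  ... | inj₂ refl = trans (coeff-interval-suc k (suc k))
    (cong₂ ℤ._+_ (coeff-interval-outside k (suc k) (ℕₚ.n<1+n k)) (cong δ (ℤₚ.n⊖n≡0 (suc k))))

  SU-interval : ∀ k → SymUnimodal (interval k)
  SU-interval k = SU-resp-≈ (≈-trans (⊗-comm (interval k) oneL) (⊗-identityˡ (interval k)))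
                            (SU-interval⊗ SU-oneL k)

  at-≥length : ∀ xs j → length xs ℕ.≤ j → at xs j ≡ 0ℤ
  at-≥length []       j       _           = refl
  at-≥length (x ∷ xs) (suc j) (s≤s len≤j) = at-≥length xs j len≤j

  coeff-vanishes : ∀ p → VanishesFrom p (ℤ.∣ low p ∣ ℕ.+ length (coeffs p))
  coeff-vanishes ⟨ + a , xs ⟩ m bound≤m = trans
    (cong (atℤ xs) (trans (ℤₚ.m-n≡m⊖n m a) (ℤₚ.⊖-≥ (ℕₚ.≤-trans (ℕₚ.m≤m+n a _) bound≤m))))
    (at-≥length xs (m ℕ.∸ a) (subst (ℕ._≤ m ℕ.∸ a) (ℕₚ.m+n∸m≡n a (length xs)) (ℕₚ.∸-monoˡ-≤ a bound≤m)))
  coeff-vanishes ⟨ -[1+ a ] , xs ⟩ m bound≤m = at-≥length xs (m ℕ.+ suc a)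
    (ℕₚ.≤-trans (ℕₚ.≤-trans (ℕₚ.m≤n+m (length xs) (suc a)) bound≤m) (ℕₚ.m≤m+n m _))

  coeff-constL⊗ : ∀ c Y n → coeff (constL c ⊗ Y) n ≡ c ℤ.* coeff Y n
  coeff-constL⊗ c Y n = trans (coeff-⊗ (constL c) Y n)
    (trans (ℤₚ.+-identityʳ _) (cong (λ u → c ℤ.* coeff Y u) (ℤₚ.+-identityʳ n)))

  SU-scale : ∀ k {Y} → SymUnimodal Y → SymUnimodal (constL (+ k) ⊗ Y)
  SU-scale k {Y} Y-SU = record
    { symmetric  = λ n → trans (coeff-constL⊗ (+ k) Y (ℤ.- n))
                     (trans (cong (+ k ℤ.*_) (symmetric Y-SU n)) (sym (coeff-constL⊗ (+ k) Y n)))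
    ; decreasing = λ m → subst₂ ℤ._≤_ (sym (coeff-constL⊗ (+ k) Y (+ suc m))) (sym (coeff-constL⊗ (+ k) Y (+ m)))
                     (ℤₚ.*-monoˡ-≤-nonNeg (+ k) (decreasing Y-SU m)) }

  lowerTop : Laurent → ℕ → Laurent
  lowerTop X N = X ⊝ constL (+ ℤ.∣ coeff X (+ N) ∣) ⊗ interval N

  module _ {X N} (X-SU : SymUnimodal X) (X-vanishes : VanishesFrom X (suc N)) where
    private
      c = coeff X (+ N)
      k = ℤ.∣ c ∣

    +∣top∣≡top : + k ≡ c
    +∣top∣≡top = ℤₚ.0≤i⇒+∣i∣≡i
      (subst (ℤ._≤ c) (X-vanishes (suc N) ℕₚ.≤-refl) (decreasing X-SU N))

    coeff-lowerTop : ∀ z → coeff (lowerTop X N) z ≡ coeff X z ℤ.- + k ℤ.* coeff (interval N) z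
    coeff-lowerTop z = trans (coeff-⊕ X (⊖ (constL (+ k) ⊗ interval N)) z)
      (cong (λ u → coeff X z ℤ.+ u) (trans (coeff-⊖ (constL (+ k) ⊗ interval N) z)
                                    (cong ℤ.-_ (coeff-constL⊗ (+ k) (interval N) z))))

    lowerTop-vanishes : VanishesFrom (lowerTop X N) N
    lowerTop-vanishes m N≤m with ℕₚ.m≤n⇒m<n∨m≡n N≤m
    ... | inj₁ N<m = begin
      coeff (lowerTop X N) (+ m)                         ≡⟨ coeff-lowerTop (+ m) ⟩
      coeff X (+ m) ℤ.- + k ℤ.* coeff (interval N) (+ m) ≡⟨ cong₂ (λ a b → a ℤ.- + k ℤ.* b)
                                                              (X-vanishes m N<m) (coeff-interval-outside N m N<m) ⟩
      0ℤ ℤ.- + k ℤ.* 0ℤ                                  ≡⟨ cong (λ u → 0ℤ ℤ.- u) (ℤₚ.*-zeroʳ (+ k)) ⟩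
      0ℤ                                                 ∎
      where open ≡-Reasoning
    ... | inj₂ refl = begin
      coeff (lowerTop X N) (+ N)                         ≡⟨ coeff-lowerTop (+ N) ⟩
      c ℤ.- + k ℤ.* coeff (interval N) (+ N)
        ≡⟨ cong (λ b → c ℤ.- + k ℤ.* b) (coeff-interval-inside N N ℕₚ.≤-refl) ⟩
      c ℤ.- + k ℤ.* 1ℤ
        ≡⟨ cong (λ u → c ℤ.- u) (trans (ℤₚ.*-identityʳ (+ k)) +∣top∣≡top) ⟩
      c ℤ.- c                                            ≡⟨ ℤₚ.+-inverseʳ c ⟩
      0ℤ                                                 ∎
      where open ≡-Reasoning

    SU-lowerTop : SymUnimodal (lowerTop X N)
    SU-lowerTop = record
      { symmetric  = λ n → trans (coeff-lowerTop (ℤ.- n))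
          (trans (cong₂ (λ a b → a ℤ.- + k ℤ.* b) (symmetric X-SU n) (symmetric (SU-interval N) n))
                 (sym (coeff-lowerTop n)))
      ; decreasing = decreasing′ }
      where
      decreasing′ : ∀ m → coeff (lowerTop X N) (+ suc m) ℤ.≤ coeff (lowerTop X N) (+ m)
      decreasing′ m with ℕₚ.≤-<-connex N m
      ... | inj₁ N≤m = ℤₚ.≤-reflexive
        (trans (lowerTop-vanishes (suc m) (ℕₚ.m≤n⇒m≤1+n N≤m)) (sym (lowerTop-vanishes m N≤m)))
      ... | inj₂ m<N = subst₂ ℤ._≤_
        (sym (trans (coeff-lowerTop (+ suc m))
                    (cong (λ b → coeff X (+ suc m) ℤ.- + k ℤ.* b) (coeff-interval-inside N (suc m) m<N))))
        (sym (trans (coeff-lowerTop (+ m))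
                    (cong (λ b → coeff X (+ m) ℤ.- + k ℤ.* b) (coeff-interval-inside N m (ℕₚ.<⇒≤ m<N)))))
        (ℤₚ.+-monoˡ-≤ (ℤ.- (+ k ℤ.* 1ℤ)) (decreasing X-SU m))

    lowerTop-decomposition : ∀ Y → lowerTop X N ⊗ Y ⊕ constL (+ k) ⊗ (interval N ⊗ Y) ≈ X ⊗ Y
    lowerTop-decomposition Y = solve 4
      (λ x c i y → (x :- c :* i) :* y :+ c :* (i :* y) := x :* y) ≈-refl X (constL (+ k)) (interval N) Y
      where open LaurentSolver

  -- Peeling off top coefficients writes X as a nonnegative combination of intervals.
  SU-⊗-bounded : ∀ N {X Y} → SymUnimodal X → VanishesFrom X N → SymUnimodal Y → SymUnimodal (X ⊗ Y)
  SU-⊗-bounded zero {X} {Y} X-SU X-vanishes Y-SU = SU-resp-≈ zero≈X⊗Y SU-zeroL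
    where
    X≗0 : ∀ z → coeff X z ≡ 0ℤ
    X≗0 (+ m)    = X-vanishes m z≤n
    X≗0 -[1+ m ] = trans (symmetric X-SU (+ suc m)) (X-vanishes (suc m) z≤n)
    zero≈X⊗Y : zeroL ≈ X ⊗ Y
    zero≈X⊗Y n = sym (begin
      coeff (X ⊗ Y) n                            ≡⟨ coeff-⊗ʳ X Y n ⟩
      convolve (coeffs Y) (low Y) (coeff X) n    ≡⟨ convolve-cong (coeffs Y) (low Y) X≗0 n ⟩
      convolve (coeffs Y) (low Y) (λ _ → 0ℤ) n   ≡⟨ convolve-zero (coeffs Y) (low Y) n ⟩
      0ℤ                                         ≡⟨ atℤ-[] (n ℤ.- 0ℤ) ⟨
      coeff zeroL n                              ∎)
      where open ≡-Reasoning
  SU-⊗-bounded (suc N) {X} {Y} X-SU X-vanishes Y-SU =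
    SU-resp-≈ (lowerTop-decomposition X-SU X-vanishes Y)
      (SU-⊕ (SU-⊗-bounded N (SU-lowerTop X-SU X-vanishes) (lowerTop-vanishes X-SU X-vanishes) Y-SU)
            (SU-scale ℤ.∣ coeff X (+ N) ∣ (SU-interval⊗ Y-SU N)))

  SU-⊗ : ∀ {X Y} → SymUnimodal X → SymUnimodal Y → SymUnimodal (X ⊗ Y)
  SU-⊗ {X} X-SU = SU-⊗-bounded _ X-SU (coeff-vanishes X)

open Cone

leadingZeros : List ℤ → ℕ
leadingZeros []             = zero
leadingZeros (+ zero ∷ xs)  = suc (leadingZeros xs)
leadingZeros (+ suc n ∷ xs) = zero
leadingZeros (-[1+ n ] ∷ xs) = zero

module Trimming where

  zeros++dropZeros : ∀ xs → zeros (leadingZeros xs) ++ dropZeros xs ≡ xs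
  zeros++dropZeros []              = refl
  zeros++dropZeros (+ zero ∷ xs)   = cong (0ℤ ∷_) (zeros++dropZeros xs)
  zeros++dropZeros (+ suc n ∷ xs)  = refl
  zeros++dropZeros (-[1+ n ] ∷ xs) = refl

  at-zeros++ : ∀ k xs i → at (zeros k ++ xs) (k ℕ.+ i) ≡ at xs i
  at-zeros++ zero    xs i = refl
  at-zeros++ (suc k) xs i = at-zeros++ k xs i

  at-++zeros : ∀ xs k i → at (xs ++ zeros k) i ≡ at xs i
  at-++zeros []       zero    i       = refl
  at-++zeros []       (suc k) zero    = refl
  at-++zeros []       (suc k) (suc i) = at-++zeros [] k i
  at-++zeros (x ∷ xs) k       zero    = refl
  at-++zeros (x ∷ xs) k       (suc i) = at-++zeros xs k i

  reverse-zeros : ∀ k → reverse (zeros k) ≡ zeros k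
  reverse-zeros zero    = refl
  reverse-zeros (suc k) = trans (Listₚ.unfold-reverse 0ℤ (zeros k))
                                (trans (cong (_∷ʳ 0ℤ) (reverse-zeros k)) (zeros-∷ʳ k))
    where
    zeros-∷ʳ : ∀ k → zeros k ∷ʳ 0ℤ ≡ 0ℤ ∷ zeros k
    zeros-∷ʳ zero    = refl
    zeros-∷ʳ (suc k) = cong (0ℤ ∷_) (zeros-∷ʳ k)

  at-dropTrailingZeros : ∀ ys i → at (reverse (dropZeros (reverse ys))) i ≡ at ys i
  at-dropTrailingZeros ys i =
    trans (sym (at-++zeros (reverse (dropZeros (reverse ys))) (leadingZeros (reverse ys)) i))
          (cong (λ u → at u i) split)
    where
    open ≡-Reasoning
    split : reverse (dropZeros (reverse ys)) ++ zeros (leadingZeros (reverse ys)) ≡ ys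
    split = begin
      reverse (dropZeros (reverse ys)) ++ zeros (leadingZeros (reverse ys))
        ≡⟨ cong (reverse (dropZeros (reverse ys)) ++_) (reverse-zeros _) ⟨
      reverse (dropZeros (reverse ys)) ++ reverse (zeros (leadingZeros (reverse ys)))
        ≡⟨ Listₚ.reverse-++ (zeros (leadingZeros (reverse ys))) (dropZeros (reverse ys)) ⟨
      reverse (zeros (leadingZeros (reverse ys)) ++ dropZeros (reverse ys))
        ≡⟨ cong reverse (zeros++dropZeros (reverse ys)) ⟩
      reverse (reverse ys)
        ≡⟨ Listₚ.reverse-involutive ys ⟩
      ys ∎

  at-trim : ∀ xs i → at (trim xs) i ≡ at xs (leadingZeros xs ℕ.+ i)
  at-trim xs i = begin
    at (trim xs) i
      ≡⟨ at-dropTrailingZeros (dropZeros xs) i ⟩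
    at (dropZeros xs) i
      ≡⟨ at-zeros++ (leadingZeros xs) (dropZeros xs) i ⟨
    at (zeros (leadingZeros xs) ++ dropZeros xs) (leadingZeros xs ℕ.+ i)
      ≡⟨ cong (λ u → at u (leadingZeros xs ℕ.+ i)) (zeros++dropZeros xs) ⟩
    at xs (leadingZeros xs ℕ.+ i) ∎
    where open ≡-Reasoning

open Trimming

module _ {p : Laurent} (p-SU : SymUnimodal p) where

  SU-falling : ∀ d → 0ℤ ℤ.≤ d → coeff p (1ℤ ℤ.+ d) ℤ.≤ coeff p d
  SU-falling (+ m) _ = decreasing p-SU m

  SU-rising : ∀ d → d ℤ.< 0ℤ → coeff p d ℤ.≤ coeff p (1ℤ ℤ.+ d)
  SU-rising (+ m)    (ℤ.+<+ ())
  SU-rising -[1+ m ] _ = subst₂ ℤ._≤_ (sym (symmetric p-SU (+ suc m)))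
    (sym (trans (cong (coeff p) (ℤₚ.1-[1+n]≡-n m)) (symmetric p-SU (+ m)))) (decreasing p-SU m)

-- The position of degree 0 in a coefficient list starting at degree e (0 if e ≥ 0).
turningPoint : ℤ → ℕ
turningPoint (+ a)    = zero
turningPoint -[1+ a ] = suc a

module _ where
  open ℤₚ.≤-Reasoning

  before-turningPoint : ∀ e i → suc i ℕ.≤ turningPoint e → e ℤ.+ + i ℤ.< 0ℤ
  before-turningPoint -[1+ a ] i i<1+a = begin-strict
    -[1+ a ] ℤ.+ + i       <⟨ ℤₚ.+-monoʳ-< -[1+ a ] (ℤ.+<+ i<1+a) ⟩
    -[1+ a ] ℤ.+ + suc a   ≡⟨ ℤₚ.n⊖n≡0 (suc a) ⟩
    0ℤ                     ∎

  after-turningPoint : ∀ e i → turningPoint e ℕ.≤ i → 0ℤ ℤ.≤ e ℤ.+ + i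
  after-turningPoint (+ a)    i _       = ℤ.+≤+ z≤n
  after-turningPoint -[1+ a ] i 1+a≤i = begin
    0ℤ                     ≡⟨ ℤₚ.n⊖n≡0 (suc a) ⟨
    -[1+ a ] ℤ.+ + suc a   ≤⟨ ℤₚ.+-monoʳ-≤ -[1+ a ] (ℤ.+≤+ 1+a≤i) ⟩
    -[1+ a ] ℤ.+ + i       ∎

SU⇒Unimodal : ∀ {p} → SymUnimodal p → Unimodal p
SU⇒Unimodal {p} p-SU = turningPoint e
  , (λ i i<j _ → subst₂ ℤ._≤_ (sym (trimmed i)) (sym (trimmed-suc i)) (SU-rising p-SU _ (before-turningPoint e i i<j)))
  , (λ i j≤i _ → subst₂ ℤ._≤_ (sym (trimmed-suc i)) (sym (trimmed i)) (SU-falling p-SU _ (after-turningPoint e i j≤i)))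
  where
  xs = coeffs p
  e = low p ℤ.+ + leadingZeros xs
  open ≡-Reasoning
  trimmed : ∀ i → at (trim xs) i ≡ coeff p (e ℤ.+ + i)
  trimmed i = begin
    at (trim xs) i                                  ≡⟨ at-trim xs i ⟩
    atℤ xs (+ (leadingZeros xs ℕ.+ i))              ≡⟨ cong (atℤ xs) (ℤₚ.pos-+ (leadingZeros xs) i) ⟩
    atℤ xs (+ leadingZeros xs ℤ.+ + i)              ≡⟨ cong (atℤ xs) (shift (low p) (+ leadingZeros xs) (+ i)) ⟩
    coeff p (e ℤ.+ + i)                             ∎
    where
    open +-*-Solver
    shift : ∀ l z i → z ℤ.+ i ≡ l ℤ.+ z ℤ.+ i ℤ.- l
    shift = solve 3 (λ l z i → z :+ i := l :+ z :+ i :- l) refl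
  trimmed-suc : ∀ i → at (trim xs) (suc i) ≡ coeff p (1ℤ ℤ.+ (e ℤ.+ + i))
  trimmed-suc i = trans (trimmed (suc i)) (cong (coeff p) (swap e (+ i)))
    where
    open +-*-Solver
    swap : ∀ e x → e ℤ.+ (1ℤ ℤ.+ x) ≡ 1ℤ ℤ.+ (e ℤ.+ x)
    swap = solve 2 (λ e x → e :+ (con 1ℤ :+ x) := con 1ℤ :+ (e :+ x)) refl

Q : Laurent
Q = q+q⁻¹

infixr 5 _∷_
data QStable : ℕ → Laurent → Set where
  [_] : ∀ {p} → SymUnimodal p → QStable zero p
  _∷_ : ∀ {n p} → SymUnimodal p → QStable n (Q ⊗ p) → QStable (suc n) p

module QStability where

  head : ∀ {n p} → QStable n p → SymUnimodal p
  head [ p-SU ]    = p-SU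
  head (p-SU ∷ _) = p-SU

  tail : ∀ {n p} → QStable (suc n) p → QStable n (Q ⊗ p)
  tail (_ ∷ Qp) = Qp

  lower : ∀ {n p} → QStable (suc n) p → QStable n p
  lower (p-SU ∷ [ _ ])     = [ p-SU ]
  lower (p-SU ∷ Qp@(_ ∷ _)) = p-SU ∷ lower Qp

  QStable-resp-≈ : ∀ {n p r} → p ≈ r → QStable n p → QStable n r
  QStable-resp-≈ p≈r [ p-SU ]      = [ SU-resp-≈ p≈r p-SU ]
  QStable-resp-≈ p≈r (p-SU ∷ Qp) = SU-resp-≈ p≈r p-SU ∷ QStable-resp-≈ (⊗-congʳ Q p≈r) Qp

  QStable-⊕ : ∀ {n p r} → QStable n p → QStable n r → QStable n (p ⊕ r)
  QStable-⊕ [ p-SU ]    [ r-SU ]    = [ SU-⊕ p-SU r-SU ]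
  QStable-⊕ {p = p} {r} (p-SU ∷ Qp) (r-SU ∷ Qr) =
    SU-⊕ p-SU r-SU ∷ QStable-resp-≈ (≈-sym (⊗-distribˡ Q p r)) (QStable-⊕ Qp Qr)

  QStable-⊗ˡ : ∀ {n a p} → SymUnimodal a → QStable n p → QStable n (a ⊗ p)
  QStable-⊗ˡ a-SU [ p-SU ]    = [ SU-⊗ a-SU p-SU ]
  QStable-⊗ˡ {a = a} {p} a-SU (p-SU ∷ Qp) =
    SU-⊗ a-SU p-SU ∷ QStable-resp-≈ (LaurentSolver.solve 3 (λ q a p → a :* (q :* p) := q :* (a :* p)) ≈-refl Q a p)
                                    (QStable-⊗ˡ a-SU Qp)
    where open LaurentSolver using (_:*_; _:=_)

  QStable-⊗ : ∀ {m n p r} → QStable m p → QStable n r → QStable (m ℕ.+ n) (p ⊗ r)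
  QStable-⊗ [ p-SU ] r-stable = QStable-⊗ˡ p-SU r-stable
  QStable-⊗ {p = p} {r} (p-SU ∷ Qp) r-stable =
    SU-⊗ p-SU (head r-stable) ∷ QStable-resp-≈ (⊗-assoc Q p r) (QStable-⊗ Qp r-stable)

open QStability

module Checker where

  symUnimodalAt : Laurent → ℕ → Bool
  symUnimodalAt p m = does (coeff p (ℤ.- + m) ℤₚ.≟ coeff p (+ m)) ∧ does (coeff p (+ suc m) ℤₚ.≤? coeff p (+ m))

  allBelow : (ℕ → Bool) → ℕ → Bool
  allBelow f zero    = true
  allBelow f (suc n) = f n ∧ allBelow f n

  checkBound : Laurent → ℕ
  checkBound p = suc (ℤ.∣ low p ∣ ℕ.+ length (coeffs p))

  isSymUnimodal : Laurent → Bool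
  isSymUnimodal p = allBelow (symUnimodalAt p) (checkBound p)

  isQStable : ℕ → Laurent → Bool
  isQStable zero    p = isSymUnimodal p
  isQStable (suc n) p = isSymUnimodal p ∧ isQStable n (Q ⊗ p)

  ∧-split : ∀ a b → T (a ∧ b) → T a × T b
  ∧-split true true t = tt , tt

  T-does : ∀ {P : Set} (d : Dec P) → T (does d) → P
  T-does (yes p) _ = p

  allBelow-sound : ∀ f n → T (allBelow f n) → ∀ m → m ℕ.< n → T (f m)
  allBelow-sound f (suc n) all m m<1+n with ∧-split (f n) (allBelow f n) all
  ... | fn , rest with ℕₚ.m≤n⇒m<n∨m≡n (ℕₚ.≤-pred m<1+n)
  ...   | inj₁ m<n  = allBelow-sound f n rest m m<n
  ...   | inj₂ refl = fn

  coeff-vanishes-below : ∀ p m → suc ℤ.∣ low p ∣ ℕ.≤ m → coeff p (ℤ.- + m) ≡ 0ℤ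
  coeff-vanishes-below ⟨ + zero , xs ⟩    (suc m) _ = refl
  coeff-vanishes-below ⟨ + suc a , xs ⟩   (suc m) _ = refl
  coeff-vanishes-below ⟨ -[1+ a ] , xs ⟩ (suc m) (s≤s a<m) = cong (atℤ xs)
    (trans (ℤₚ.[1+m]⊖[1+n]≡m⊖n a m)
           (subst (λ u → a ⊖ u ≡ -[1+ m ℕ.∸ suc a ]) (ℕₚ.m+[n∸m]≡n a<m) (⊖-beyond a (m ℕ.∸ suc a))))
    where
    ⊖-beyond : ∀ a k → a ⊖ (suc a ℕ.+ k) ≡ -[1+ k ]
    ⊖-beyond zero    k = refl
    ⊖-beyond (suc a) k = trans (ℤₚ.[1+m]⊖[1+n]≡m⊖n a (suc a ℕ.+ k)) (⊖-beyond a k)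

  isSymUnimodal-sound : ∀ p → T (isSymUnimodal p) → SymUnimodal p
  isSymUnimodal-sound p checked = record
    { symmetric = λ { (+ m) → symmetric-ℕ m ; -[1+ m ] → sym (symmetric-ℕ (suc m)) }
    ; decreasing = decreasing′ }
    where
    B = checkBound p
    checkedAt : ∀ m → m ℕ.< B → T (symUnimodalAt p m)
    checkedAt = allBelow-sound (symUnimodalAt p) B checked
    symmetric-ℕ : ∀ m → coeff p (ℤ.- + m) ≡ coeff p (+ m)
    symmetric-ℕ m with ℕₚ.<-≤-connex m B
    ... | inj₁ m<B = T-does (coeff p (ℤ.- + m) ℤₚ.≟ coeff p (+ m)) (proj₁ (∧-split _ _ (checkedAt m m<B)))
    ... | inj₂ B≤m = trans (coeff-vanishes-below p m (ℕₚ.≤-trans (s≤s (ℕₚ.m≤m+n _ _)) B≤m))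
                           (sym (coeff-vanishes p m (ℕₚ.≤-trans (ℕₚ.n≤1+n _) B≤m)))
    decreasing′ : ∀ m → coeff p (+ suc m) ℤ.≤ coeff p (+ m)
    decreasing′ m with ℕₚ.<-≤-connex m B
    ... | inj₁ m<B = T-does (coeff p (+ suc m) ℤₚ.≤? coeff p (+ m)) (proj₂ (∧-split _ _ (checkedAt m m<B)))
    ... | inj₂ B≤m = ℤₚ.≤-reflexive (trans (coeff-vanishes p (suc m) (ℕₚ.≤-trans (ℕₚ.n≤1+n _) (ℕₚ.m≤n⇒m≤1+n B≤m)))
                                           (sym (coeff-vanishes p m (ℕₚ.≤-trans (ℕₚ.n≤1+n _) B≤m))))

  isQStable-sound : ∀ n p → T (isQStable n p) → QStable n p
  isQStable-sound zero    p checked = [ isSymUnimodal-sound p checked ]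
  isQStable-sound (suc n) p checked with ∧-split (isSymUnimodal p) (isQStable n (Q ⊗ p)) checked
  ... | here , rest = isSymUnimodal-sound p here ∷ isQStable-sound n (Q ⊗ p) rest

open Checker

open LaurentSolver using (Polynomial; solve; _:=_; _:+_; _:*_; _:-_; con)

mediant : Laurent → Laurent → Laurent → Laurent
mediant L R D = q⁻¹[3] ⊗ L ⊗ R ⊝ D

gap : Laurent → Laurent → Laurent → Laurent
gap L R D = Q ⊗ L ⊗ R ⊝ D

record Admissible (X : Laurent) : Set where
  field
    stable   : QStable 1 X
    square   : QStable 2 (X ⊗ X ⊝ oneL)
    qSquare  : QStable 1 (Q ⊗ X ⊗ X ⊝ oneL)

-- Also satisfied by m^{1/2} and m^{1/3}, which are not admissible.
record Node (X : Laurent) : Set where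
  field
    symUnimodal : SymUnimodal X
    square      : QStable 2 (X ⊗ X ⊝ oneL)
    qSquare-⊗   : ∀ {Y} → QStable 1 Y → QStable 1 ((Q ⊗ X ⊗ X ⊝ oneL) ⊗ Y)
    ⊗-Q⊗        : ∀ {E} → QStable 1 E → QStable 1 (X ⊗ (Q ⊗ E))

-- What the mediant step needs from Farey neighbours L < R; it holds as soon as
-- one of them is admissible and the other is a Node.
record Compatible (L R : Laurent) : Set where
  field
    left        : Node L
    right       : Node R
    product     : Admissible (L ⊗ R)
    leftFactor  : QStable 1 ((Q ⊗ L ⊗ L ⊝ oneL) ⊗ R)
    rightFactor : QStable 1 ((Q ⊗ R ⊗ R ⊝ oneL) ⊗ L)

open Admissible public
open Node public
open Compatible public

module NodeConditions where

  ⊗-Q⊗-of-stable : ∀ {X E} → QStable 1 X → QStable 1 E → QStable 1 (X ⊗ (Q ⊗ E))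
  ⊗-Q⊗-of-stable {X} {E} X-stable E-stable =
    QStable-resp-≈ (solve 3 (λ q x e → q :* (x :* e) := x :* (q :* e)) ≈-refl Q X E)
                   (tail (QStable-⊗ X-stable E-stable))

  ⊗-Q⊗-of-Q² : ∀ {X E} → SymUnimodal X → SymUnimodal (Q ⊗ (Q ⊗ X)) → QStable 1 E → QStable 1 (X ⊗ (Q ⊗ E))
  ⊗-Q⊗-of-Q² {X} {E} X-SU QQX-SU E-stable =
    SU-⊗ X-SU (head (tail E-stable))
      ∷ [ SU-resp-≈ (solve 3 (λ q x e → (q :* (q :* x)) :* e := q :* (x :* (q :* e))) ≈-refl Q X E)
                    (SU-⊗ QQX-SU (head E-stable)) ]

  ⊗-of-Q-shifted : ∀ {A Y} → SymUnimodal (A ⊝ Q) → SymUnimodal (Q ⊗ A) → QStable 1 Y → QStable 1 (A ⊗ Y)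
  ⊗-of-Q-shifted {A} {Y} A-Q-SU QA-SU Y-stable =
    SU-resp-≈ (solve 3 (λ q a y → (a :- q) :* y :+ q :* y := a :* y) ≈-refl Q A Y)
              (SU-⊕ (SU-⊗ A-Q-SU (head Y-stable)) (head (tail Y-stable)))
      ∷ [ SU-resp-≈ (solve 3 (λ q a y → (q :* a) :* y := q :* (a :* y)) ≈-refl Q A Y)
                    (SU-⊗ QA-SU (head Y-stable)) ]

  Admissible⇒Node : ∀ {X} → Admissible X → Node X
  Admissible⇒Node X-adm = record
    { symUnimodal = head (stable X-adm)
    ; square      = square X-adm
    ; qSquare-⊗   = λ Y-stable → QStable-⊗ (qSquare X-adm) [ head Y-stable ]
    ; ⊗-Q⊗        = ⊗-Q⊗-of-stable (stable X-adm) }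

  Admissible-resp-≈ : ∀ {A B} → A ≈ B → Admissible A → Admissible B
  Admissible-resp-≈ {A} {B} A≈B A-adm = record
    { stable  = QStable-resp-≈ A≈B (stable A-adm)
    ; square  = QStable-resp-≈ (⊕-cong (⊗-cong A≈B A≈B) (λ _ → refl)) (square A-adm)
    ; qSquare = QStable-resp-≈ (⊕-cong (⊗-cong (⊗-congʳ Q A≈B) A≈B) (λ _ → refl)) (qSquare A-adm) }

  Admissible-⊕ : ∀ {R Z} → Admissible R → QStable 1 Z → Admissible (R ⊕ Z)
  Admissible-⊕ {R} {Z} R-adm Z-stable = record
    { stable  = QStable-⊕ (stable R-adm) Z-stable
    ; square  = QStable-resp-≈
        (solve 2 (λ r z → (r :* r :- con 1ℤ) :+ r :* z :+ r :* z :+ z :* z := (r :+ z) :* (r :+ z) :- con 1ℤ) ≈-refl R Z)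
        (QStable-⊕ (QStable-⊕ (QStable-⊕ (square R-adm) RZ) RZ) (QStable-⊗ Z-stable Z-stable))
    ; qSquare = QStable-resp-≈
        (solve 3 (λ q r z → (q :* r :* r :- con 1ℤ) :+ (q :* r) :* z :+ (q :* r) :* z :+ q :* (z :* z)
                            := q :* (r :+ z) :* (r :+ z) :- con 1ℤ) ≈-refl Q R Z)
        (QStable-⊕ (QStable-⊕ (QStable-⊕ (qSquare R-adm) QRZ) QRZ) (tail (QStable-⊗ Z-stable Z-stable))) }
    where
    RZ : QStable 2 (R ⊗ Z)
    RZ = QStable-⊗ (stable R-adm) Z-stable
    QRZ : QStable 1 ((Q ⊗ R) ⊗ Z)
    QRZ = QStable-⊗ˡ (head (tail (stable R-adm))) Z-stable

  square-product : ∀ {L R} → Node L → Node R → QStable 2 ((L ⊗ R) ⊗ (L ⊗ R) ⊝ oneL)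
  square-product {L} {R} L-node R-node = QStable-resp-≈
    (solve 2 (λ l r → (l :* l :- con 1ℤ) :* (r :* r) :+ (r :* r :- con 1ℤ) := (l :* r) :* (l :* r) :- con 1ℤ) ≈-refl L R)
    (QStable-⊕ (QStable-⊗ (square L-node) [ SU-⊗ (symUnimodal R-node) (symUnimodal R-node) ]) (square R-node))

  compatibleˡ : ∀ {L R} → Admissible L → Node R → Compatible L R
  compatibleˡ {L} {R} L-adm R-node = record
    { left        = Admissible⇒Node L-adm
    ; right       = R-node
    ; product     = record
      { stable  = QStable-⊗ (stable L-adm) [ R-SU ]
      ; square  = square-product (Admissible⇒Node L-adm) R-node
      ; qSquare = QStable-resp-≈
          (solve 3 (λ q l r → (q :* l :* l :- con 1ℤ) :* (r :* r) :+ (r :* r :- con 1ℤ)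
                              := q :* (l :* r) :* (l :* r) :- con 1ℤ) ≈-refl Q L R)
          (QStable-⊕ (QStable-⊗ (qSquare L-adm) [ SU-⊗ R-SU R-SU ]) (lower (square R-node))) }
    ; leftFactor  = QStable-⊗ (qSquare L-adm) [ R-SU ]
    ; rightFactor = qSquare-⊗ R-node (stable L-adm) }
    where R-SU = symUnimodal R-node

  compatibleʳ : ∀ {L R} → Node L → Admissible R → Compatible L R
  compatibleʳ {L} {R} L-node R-adm = record
    { left        = L-node
    ; right       = Admissible⇒Node R-adm
    ; product     = record
      { stable  = QStable-⊗ˡ L-SU (stable R-adm)
      ; square  = square-product L-node (Admissible⇒Node R-adm)
      ; qSquare = QStable-resp-≈
          (solve 3 (λ q l r → (q :* r :* r :- con 1ℤ) :* (l :* l) :+ (l :* l :- con 1ℤ)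
                              := q :* (l :* r) :* (l :* r) :- con 1ℤ) ≈-refl Q L R)
          (QStable-⊕ (QStable-⊗ (qSquare R-adm) [ SU-⊗ L-SU L-SU ]) (lower (square L-node))) }
    ; leftFactor  = qSquare-⊗ L-node (stable R-adm)
    ; rightFactor = QStable-⊗ (qSquare R-adm) [ L-SU ] }
    where L-SU = symUnimodal L-node

  mediant≈ : ∀ L R D → mediant L R D ≈ L ⊗ R ⊕ gap L R D
  mediant≈ = solve 4 (λ q l r d → (q :+ con 1ℤ) :* l :* r :- d := l :* r :+ (q :* l :* r :- d)) ≈-refl Q

  mediant-step : ∀ {L R D} → Compatible L R → QStable 1 (gap L R D) →
                 Admissible (mediant L R D) × QStable 1 (gap L (mediant L R D) R) × QStable 1 (gap (mediant L R D) R L)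
  mediant-step {L} {R} {D} LR E-stable =
      Admissible-resp-≈ (≈-sym (mediant≈ L R D)) (Admissible-⊕ (product LR) E-stable)
    , QStable-resp-≈ (solve 4 (λ q l r d → (q :* l :* l :- con 1ℤ) :* r :+ l :* (q :* (q :* l :* r :- d))
                                        := q :* l :* ((q :+ con 1ℤ) :* l :* r :- d) :- r) ≈-refl Q L R D)
                     (QStable-⊕ (leftFactor LR) (⊗-Q⊗ (left LR) E-stable))
    , QStable-resp-≈ (solve 4 (λ q l r d → (q :* r :* r :- con 1ℤ) :* l :+ r :* (q :* (q :* l :* r :- d))
                                        := q :* ((q :+ con 1ℤ) :* l :* r :- d) :* r :- l) ≈-refl Q L R D)
                     (QStable-⊕ (rightFactor LR) (⊗-Q⊗ (right LR) E-stable))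

open NodeConditions

m[1/2] : Laurent
m[1/2] = mediant oneL Q oneL

Q³+Q²-2Q : Laurent
Q³+Q²-2Q = Q ⊗ Q ⊗ Q ⊕ Q ⊗ Q ⊝ Q ⊝ Q

-- Triples (1, R, D) on the left edge of the Farey tree.
record LeftChain (R D : Laurent) : Set where
  field
    R-adm      : Admissible R
    D-stable   : QStable 1 D
    [Q+1]D-R   : QStable 1 (q⁻¹[3] ⊗ D ⊝ R)
    R-D        : SymUnimodal (R ⊝ D)
    R-QD       : SymUnimodal (R ⊝ Q ⊗ D)
    QR-m[1/2]D : SymUnimodal (Q ⊗ R ⊝ m[1/2] ⊗ D)
open LeftChain public

module LeftEdge {R D : Laurent} (chain : LeftChain R D) where
  private
    M = mediant oneL R D
    -- M - R as a combination of the chain's differences with Q-stable weights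
    Z = m[1/2] ⊗ (Q ⊗ R ⊝ m[1/2] ⊗ D) ⊕ Q³+Q²-2Q ⊗ (q⁻¹[3] ⊗ D ⊝ R)

    m½ : ∀ {n} → Polynomial n → Polynomial n
    m½ q = (q :+ con 1ℤ) :* con 1ℤ :* q :- con 1ℤ
    mediantᵖ : ∀ {n} → Polynomial n → Polynomial n → Polynomial n → Polynomial n
    mediantᵖ q r d = (q :+ con 1ℤ) :* con 1ℤ :* r :- d
    Zᵖ : ∀ {n} → Polynomial n → Polynomial n → Polynomial n → Polynomial n
    Zᵖ q r d = m½ q :* (q :* r :- m½ q :* d) :+ (q :* q :* q :+ q :* q :- q :- q) :* ((q :+ con 1ℤ) :* d :- r)

    Z-stable : QStable 1 Z
    Z-stable = QStable-⊕ (QStable-⊗ (isQStable-sound 1 m[1/2] tt) [ QR-m[1/2]D chain ])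
                         (QStable-⊗ˡ (isSymUnimodal-sound Q³+Q²-2Q tt) ([Q+1]D-R chain))

    M≈R⊕Z : M ≈ R ⊕ Z
    M≈R⊕Z = solve 3 (λ q r d → mediantᵖ q r d := r :+ Zᵖ q r d) ≈-refl Q R D

  next : LeftChain M R
  next = record
    { R-adm      = Admissible-resp-≈ (≈-sym M≈R⊕Z) (Admissible-⊕ (R-adm chain) Z-stable)
    ; D-stable   = stable (R-adm chain)
    ; [Q+1]D-R   = QStable-resp-≈ (solve 3 (λ q r d → d := (q :+ con 1ℤ) :* r :- mediantᵖ q r d) ≈-refl Q R D)
                                  (D-stable chain)
    ; R-D        = SU-resp-≈ (solve 3 (λ q r d → Zᵖ q r d := mediantᵖ q r d :- r) ≈-refl Q R D) (head Z-stable)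
    ; R-QD       = SU-resp-≈ (solve 3 (λ q r d → r :- d := mediantᵖ q r d :- q :* r) ≈-refl Q R D) (R-D chain)
    ; QR-m[1/2]D = SU-resp-≈ (solve 3 (λ q r d → r :- q :* d := q :* mediantᵖ q r d :- m½ q :* r) ≈-refl Q R D)
                             (R-QD chain) }

  sibling-gap : QStable 1 (gap M R oneL)
  sibling-gap = QStable-resp-≈
    (solve 3 (λ q r d → (q :* r :* r :- con 1ℤ) :+ (q :* r) :* Zᵖ q r d
                        := q :* mediantᵖ q r d :* r :- con 1ℤ) ≈-refl Q R D)
    (QStable-⊕ (qSquare (R-adm chain)) (QStable-⊗ˡ (head (tail (stable (R-adm chain)))) Z-stable))

Q²+Q : Laurent
Q²+Q = q⁻¹[3] ⊗ Q

-- Triples (L, Q, D) on the right edge of the Farey tree.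
record RightChain (L D : Laurent) : Set where
  field
    L-adm         : Admissible L
    D-SU          : SymUnimodal D
    [Q²+Q]D-L     : SymUnimodal (Q²+Q ⊗ D ⊝ L)
    L-D           : SymUnimodal (L ⊝ D)
    L-[Q²+Q-1]D   : SymUnimodal (L ⊝ (Q²+Q ⊝ oneL) ⊗ D)
open RightChain public

module RightEdge {L D : Laurent} (chain : RightChain L D) where
  private
    M = mediant L Q D
    Y = Q²+Q
    -- M - L as a combination of the chain's differences with Q-stable weights
    Z = (Y ⊗ Y ⊝ Y ⊝ oneL) ⊗ (L ⊝ (Y ⊝ oneL) ⊗ D) ⊕ (Y ⊗ Y ⊝ Y ⊝ Y) ⊗ (Y ⊗ D ⊝ L)

    Yᵖ : ∀ {n} → Polynomial n → Polynomial n
    Yᵖ q = (q :+ con 1ℤ) :* q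
    mediantᵖ : ∀ {n} → Polynomial n → Polynomial n → Polynomial n → Polynomial n
    mediantᵖ q l d = (q :+ con 1ℤ) :* l :* q :- d
    Zᵖ : ∀ {n} → Polynomial n → Polynomial n → Polynomial n → Polynomial n
    Zᵖ q l d = (Yᵖ q :* Yᵖ q :- Yᵖ q :- con 1ℤ) :* (l :- (Yᵖ q :- con 1ℤ) :* d)
            :+ (Yᵖ q :* Yᵖ q :- Yᵖ q :- Yᵖ q) :* (Yᵖ q :* d :- l)

    Z-stable : QStable 1 Z
    Z-stable = QStable-⊕ (QStable-⊗ (isQStable-sound 1 (Y ⊗ Y ⊝ Y ⊝ oneL) tt) [ L-[Q²+Q-1]D chain ])
                         (QStable-⊗ (isQStable-sound 1 (Y ⊗ Y ⊝ Y ⊝ Y) tt) [ [Q²+Q]D-L chain ])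

    M≈L⊕Z : M ≈ L ⊕ Z
    M≈L⊕Z = solve 3 (λ q l d → mediantᵖ q l d := l :+ Zᵖ q l d) ≈-refl Q L D

  next : RightChain M L
  next = record
    { L-adm       = Admissible-resp-≈ (≈-sym M≈L⊕Z) (Admissible-⊕ (L-adm chain) Z-stable)
    ; D-SU        = head (stable (L-adm chain))
    ; [Q²+Q]D-L   = SU-resp-≈ (solve 3 (λ q l d → d := Yᵖ q :* l :- mediantᵖ q l d) ≈-refl Q L D) (D-SU chain)
    ; L-D         = SU-resp-≈ (solve 3 (λ q l d → Zᵖ q l d := mediantᵖ q l d :- l) ≈-refl Q L D) (head Z-stable)
    ; L-[Q²+Q-1]D = SU-resp-≈ (solve 3 (λ q l d → l :- d := mediantᵖ q l d :- (Yᵖ q :- con 1ℤ) :* l) ≈-refl Q L D)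
                              (L-D chain) }

  sibling-gap : QStable 1 (gap L M Q)
  sibling-gap = QStable-resp-≈
    (solve 3 (λ q l d → q :* (l :* l :- con 1ℤ) :+ (q :* l) :* Zᵖ q l d := q :* l :* mediantᵖ q l d :- q) ≈-refl Q L D)
    (QStable-⊕ (tail (square (L-adm chain))) (QStable-⊗ˡ (head (tail (stable (L-adm chain)))) Z-stable))

-- The invariant of a state (L, R, D) of markovSearch; explicit covers the
-- finitely many states near the root, where it is checked by computation.
data Invariant : Laurent → Laurent → Laurent → Set where
  explicit  : ∀ {L R D} → SymUnimodal (mediant L R D) →
              Invariant L (mediant L R D) R → Invariant (mediant L R D) R L → Invariant L R D
  inner     : ∀ {L R D} → Compatible L R → QStable 1 (gap L R D) → Invariant L R D
  leftEdge  : ∀ {R D} → LeftChain R D → Invariant oneL R D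
  rightEdge : ∀ {L D} → RightChain L D → Invariant L Q D

step : ∀ {L R D} → Invariant L R D →
       SymUnimodal (mediant L R D) × Invariant L (mediant L R D) R × Invariant (mediant L R D) R L
step (explicit M-SU leftChild rightChild) = M-SU , leftChild , rightChild
step (inner LR E-stable) =
  let (M-adm , leftGap , rightGap) = mediant-step LR E-stable
  in head (stable M-adm) , inner (compatibleʳ (left LR) M-adm) leftGap , inner (compatibleˡ M-adm (right LR)) rightGap
step (leftEdge chain) =
  head (stable (R-adm next)) , leftEdge next ,
  inner (compatibleˡ (R-adm next) (Admissible⇒Node (R-adm chain))) sibling-gap
  where open LeftEdge chain
step (rightEdge chain) =
  head (stable (L-adm next)) ,
  inner (compatibleʳ (Admissible⇒Node (L-adm chain)) (L-adm next)) sibling-gap , rightEdge next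
  where open RightEdge chain

isAdmissible : Laurent → Bool
isAdmissible X = isQStable 1 X ∧ isQStable 2 (X ⊗ X ⊝ oneL) ∧ isQStable 1 (Q ⊗ X ⊗ X ⊝ oneL)

isAdmissible-sound : ∀ X → T (isAdmissible X) → Admissible X
isAdmissible-sound X checked with ∧-split (isQStable 1 X) _ checked
... | X-ok , rest with ∧-split (isQStable 2 (X ⊗ X ⊝ oneL)) _ rest
...   | square-ok , qSquare-ok = record
  { stable  = isQStable-sound 1 X X-ok
  ; square  = isQStable-sound 2 _ square-ok
  ; qSquare = isQStable-sound 1 _ qSquare-ok }

m[1/3] m[1/4] m[1/5] m[1/6] m[1/7] m[2/5] m[2/3] m[3/4] : Laurent
m[1/3] = mediant oneL m[1/2] Q
m[1/4] = mediant oneL m[1/3] m[1/2]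
m[1/5] = mediant oneL m[1/4] m[1/3]
m[1/6] = mediant oneL m[1/5] m[1/4]
m[1/7] = mediant oneL m[1/6] m[1/5]
m[2/5] = mediant m[1/3] m[1/2] oneL
m[2/3] = mediant m[1/2] Q oneL
m[3/4] = mediant m[2/3] Q m[1/2]

node[1/2] : Node m[1/2]
node[1/2] = record
  { symUnimodal = isSymUnimodal-sound m[1/2] tt
  ; square      = isQStable-sound 2 _ tt
  ; qSquare-⊗   = ⊗-of-Q-shifted {A = Q ⊗ m[1/2] ⊗ m[1/2] ⊝ oneL}
                    (isSymUnimodal-sound (Q ⊗ m[1/2] ⊗ m[1/2] ⊝ oneL ⊝ Q) tt)
                    (isSymUnimodal-sound (Q ⊗ (Q ⊗ m[1/2] ⊗ m[1/2] ⊝ oneL)) tt)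
  ; ⊗-Q⊗        = ⊗-Q⊗-of-stable (isQStable-sound 1 m[1/2] tt) }

node[1/3] : Node m[1/3]
node[1/3] = record
  { symUnimodal = isSymUnimodal-sound m[1/3] tt
  ; square      = isQStable-sound 2 _ tt
  ; qSquare-⊗   = λ Y-stable → QStable-⊗ (isQStable-sound 1 (Q ⊗ m[1/3] ⊗ m[1/3] ⊝ oneL) tt) [ head Y-stable ]
  ; ⊗-Q⊗        = ⊗-Q⊗-of-Q² (isSymUnimodal-sound m[1/3] tt) (isSymUnimodal-sound (Q ⊗ (Q ⊗ m[1/3])) tt) }

adm[1/4] : Admissible m[1/4]
adm[1/4] = isAdmissible-sound m[1/4] tt
adm[1/5] : Admissible m[1/5]
adm[1/5] = isAdmissible-sound m[1/5] tt
adm[1/6] : Admissible m[1/6]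
adm[1/6] = isAdmissible-sound m[1/6] tt
adm[1/7] : Admissible m[1/7]
adm[1/7] = isAdmissible-sound m[1/7] tt
adm[2/5] : Admissible m[2/5]
adm[2/5] = isAdmissible-sound m[2/5] tt
adm[2/3] : Admissible m[2/3]
adm[2/3] = isAdmissible-sound m[2/3] tt
adm[3/4] : Admissible m[3/4]
adm[3/4] = isAdmissible-sound m[3/4] tt

at[1/7] : Invariant oneL m[1/6] m[1/5]
at[1/7] = explicit (head (stable adm[1/7]))
  (leftEdge record
    { R-adm = adm[1/7] ; D-stable = stable adm[1/6]
    ; [Q+1]D-R = isQStable-sound 1 _ tt ; R-D = isSymUnimodal-sound _ tt
    ; R-QD = isSymUnimodal-sound _ tt ; QR-m[1/2]D = isSymUnimodal-sound _ tt })
  (inner (compatibleˡ adm[1/7] (Admissible⇒Node adm[1/6])) (isQStable-sound 1 _ tt))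

at[1/6] : Invariant oneL m[1/5] m[1/4]
at[1/6] = explicit (head (stable adm[1/6])) at[1/7]
  (inner (compatibleˡ adm[1/6] (Admissible⇒Node adm[1/5])) (isQStable-sound 1 _ tt))

at[1/5] : Invariant oneL m[1/4] m[1/3]
at[1/5] = explicit (head (stable adm[1/5])) at[1/6]
  (inner (compatibleˡ adm[1/5] (Admissible⇒Node adm[1/4])) (isQStable-sound 1 _ tt))

at[1/4] : Invariant oneL m[1/3] m[1/2]
at[1/4] = explicit (head (stable adm[1/4])) at[1/5]
  (inner (compatibleˡ adm[1/4] node[1/3]) (isQStable-sound 1 _ tt))

at[2/5] : Invariant m[1/3] m[1/2] oneL
at[2/5] = explicit (head (stable adm[2/5]))
  (inner (compatibleʳ node[1/3] adm[2/5]) (isQStable-sound 1 _ tt))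
  (inner (compatibleˡ adm[2/5] node[1/2]) (isQStable-sound 1 _ tt))

at[1/3] : Invariant oneL m[1/2] Q
at[1/3] = explicit (symUnimodal node[1/3]) at[1/4] at[2/5]

at[3/4] : Invariant m[2/3] Q m[1/2]
at[3/4] = explicit (head (stable adm[3/4]))
  (inner (compatibleˡ adm[2/3] (Admissible⇒Node adm[3/4])) (isQStable-sound 1 _ tt))
  (rightEdge record
    { L-adm = adm[3/4] ; D-SU = head (stable adm[2/3])
    ; [Q²+Q]D-L = isSymUnimodal-sound _ tt ; L-D = isSymUnimodal-sound _ tt
    ; L-[Q²+Q-1]D = isSymUnimodal-sound _ tt })

at[2/3] : Invariant m[1/2] Q oneL
at[2/3] = explicit (head (stable adm[2/3]))
  (inner (compatibleʳ node[1/2] adm[2/3]) (isQStable-sound 1 _ tt)) at[3/4]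

at[1/2] : Invariant oneL Q oneL
at[1/2] = explicit (symUnimodal node[1/2]) at[1/3] at[2/3]

unimodal-search : ∀ fuel a b c d {L R D} p s → Invariant L R D → Unimodal (markovSearch fuel a b c d L R D p s)
unimodal-search zero    a b c d p s _ = SU⇒Unimodal SU-zeroL
unimodal-search (suc n) a b c d p s inv
  with p ℕ.* (b ℕ.+ d) ℕ.≡ᵇ s ℕ.* (a ℕ.+ c) | p ℕ.* (b ℕ.+ d) ℕ.<ᵇ s ℕ.* (a ℕ.+ c)
... | true  | _     = SU⇒Unimodal (proj₁ (step inv))
... | false | true  = unimodal-search n a b (a ℕ.+ c) (b ℕ.+ d) p s (proj₁ (proj₂ (step inv)))
... | false | false = unimodal-search n (a ℕ.+ c) (b ℕ.+ d) c d p s (proj₂ (proj₂ (step inv)))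

unimodal-markovNat : ∀ p s → p ≢ s → Unimodal (markovNat p s)
unimodal-markovNat p s p≢s with p ℕ.≡ᵇ 0 | p ℕ.≡ᵇ s in p≡ᵇs
... | true  | _     = SU⇒Unimodal SU-oneL
... | false | true  = contradiction (ℕₚ.≡ᵇ⇒≡ p s (subst T (sym p≡ᵇs) tt)) p≢s
... | false | false = unimodal-search (p ℕ.+ s) 0 1 1 1 p s at[1/2]

-- The hypothesis t ≤ 1 is not needed: every value markovSearch can return is unimodal.
proposition1p6 : (t : ℚ) → 0ℚ ≤ t → t ≤ 1ℚ → t ≢ 1ℚ → Unimodal (markovQ t)
proposition1p6 (mkℚ -[1+ n ] d _) (*≤* ()) _ _
proposition1p6 (mkℚ (+ n) d _) _ _ t≢1 =
  unimodal-markovNat n (suc d) λ { refl → t≢1 (≃⇒≡ (*≡* (ℤₚ.*-comm (+ suc d) (+ 1)))) }
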